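{- Let $k$ be a positive integer, $m_0$ a nonnegative integer and $u=(u_1,\dots,u_{k+1})\in\mathbb{Z}^{k+1}$ with $u_1\leq u_2\leq\cdots\leq u_{k+1}$. Define \[ \mathcal{F}_{m_0;u}(q):=\sum_{m_1,\dots,m_k\geq 0} \frac{q^{\sum_{i=1}^k m_i(m_i+u_i)}}{(q)_{m_k+u_{k+1}}} \prod_{i=1}^k {m_{i-1} \brack m_i}. \] Then for every $\ell\in\{0,1,\dots,k\}$, \[ \mathcal{F}_{m_0;u}(q)=\sum_{m_1,\dots,m_k\geq 0} \frac{q^{\sum_{i=1}^k m_i(m_i+u_i)}} {(q)_{m_{\ell}+m_{\ell+1}+u_{\ell+1}}} \prod_{i=1}^{\ell} {m_{i-1} \brack m_i} \prod_{i=\ell+1}^k {m_{i+1}+u_{i+1}-u_i \brack m_i}, \] where $m_{k+1}:=0$.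
   Context: $(q)_n=(q;q)_n=(q;q)_\infty/(q^{n+1};q)_\infty$ for $n\in\mathbb{Z}$, where $(a;q)_\infty=\prod_{i\ge0}(1-aq^i)$; in particular $1/(q)_n=0$ for $n<0$. For $n,m\in\mathbb{Z}$, ${n\brack m}=\frac{(q)_n}{(q)_m(q)_{n-m}}$ if $0\leq m\leq n$ and $0$ otherwise. Empty products are $1$. -}

module Defs where

open import Data.Nat as ℕ using (ℕ; zero; suc; _∸_; _%_; _≡ᵇ_)
open import Data.Integer as ℤ using (ℤ; +_; -[1+_]; _+_; _-_; _*_; 0ℤ; 1ℤ)
open import Data.List using (List; []; _∷_; foldr; map; concatMap; upTo)
open import Data.Vec using (Vec; []; _∷_)
open import Data.Bool using (if_then_else_)

-- Formal power series in q with integer coefficients: n ↦ coeff of q^n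
Series : Set
Series = ℕ → ℤ

-- Formal Laurent series: N ↦ coeff of q^N (N ∈ ℤ)
LSeries : Set
LSeries = ℤ → ℤ

sumℤ : List ℤ → ℤ
sumℤ = foldr _+_ 0ℤ

_⊛_ : Series → Series → Series
(f ⊛ g) n = sumℤ (map (λ i → f i * g (n ∸ i)) (upTo (suc n)))

oneS : Series
oneS zero    = 1ℤ
oneS (suc _) = 0ℤ

zeroS : Series
zeroS _ = 0ℤ

prodS : List Series → Series
prodS = foldr _⊛_ oneS

upFrom : ℕ → ℕ → List ℕ
upFrom a zero    = []
upFrom a (suc n) = a ∷ upFrom (suc a) n

oneMinusQ : ℕ → Series
oneMinusQ i n = (if n ≡ᵇ 0 then 1ℤ else 0ℤ) - (if n ≡ᵇ i then 1ℤ else 0ℤ)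

-- the series 1/(1 - q^i) = Σ_{j≥0} q^{ij}   (used for i ≥ 1)
geomInv : ℕ → Series
geomInv zero    n = 0ℤ
geomInv (suc i) n = if (n % suc i) ≡ᵇ 0 then 1ℤ else 0ℤ

poch : ℕ → Series
poch n = prodS (map oneMinusQ (upFrom 1 n))

invPoch : ℕ → Series
invPoch n = prodS (map geomInv (upFrom 1 n))

-- 1/(q)_n for n ∈ ℤ, which is 0 for n < 0
invPochℤ : ℤ → Series
invPochℤ (+ n)    = invPoch n
invPochℤ -[1+ _ ] = zeroS

qbinom : ℤ → ℤ → Series
qbinom n -[1+ _ ] = zeroS
qbinom n (+ a) with n - + a
... | -[1+ _ ] = zeroS
... | + b      = (poch (a ℕ.+ b) ⊛ invPoch a) ⊛ invPoch b

-- q^e · S as a Laurent series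
shiftL : ℤ → Series → LSeries
shiftL e S N with N - e
... | + j      = S j
... | -[1+ _ ] = 0ℤ

sumL : List LSeries → LSeries
sumL xs N = sumℤ (map (λ f → f N) xs)

-- Summation index tuples (m_1,...,m_k), truncated to the box [0,B]^k

box : ℕ → (k : ℕ) → List (Vec ℕ k)
box B zero    = [] ∷ []
box B (suc k) = concatMap (λ x → map (x ∷_) (box B k)) (upTo (suc B))

vget : ∀ {k} → Vec ℕ k → ℕ → ℕ
vget []       _       = 0
vget (x ∷ xs) zero    = x
vget (x ∷ xs) (suc i) = vget xs i

-- m_i with m_0 given and m_i := 0 for i ≥ k+1 (in particular m_{k+1} = 0)
mAt : ∀ {k} → ℕ → Vec ℕ k → ℕ → ℤ
mAt m0 v zero    = + m0
mAt m0 v (suc i) = + vget v i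

expo : (k : ℕ) → ℕ → (ℕ → ℤ) → Vec ℕ k → ℤ
expo k m0 u v = sumℤ (map (λ i → mAt m0 v i * (mAt m0 v i + u i)) (upFrom 1 k))

termL : (k : ℕ) → ℕ → (ℕ → ℤ) → Vec ℕ k → LSeries
termL k m0 u v =
  shiftL (expo k m0 u v)
    (invPochℤ (mAt m0 v k + u (suc k))
     ⊛ prodS (map (λ i → qbinom (mAt m0 v (i ∸ 1)) (mAt m0 v i)) (upFrom 1 k)))

termR : (k : ℕ) → ℕ → (ℕ → ℤ) → ℕ → Vec ℕ k → LSeries
termR k m0 u ℓ v =
  shiftL (expo k m0 u v)
    ((invPochℤ (mAt m0 v ℓ + mAt m0 v (suc ℓ) + u (suc ℓ))
      ⊛ prodS (map (λ i → qbinom (mAt m0 v (i ∸ 1)) (mAt m0 v i)) (upFrom 1 ℓ)))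
     ⊛ prodS (map (λ i → qbinom (mAt m0 v (suc i) + u (suc i) - u i) (mAt m0 v i))
                  (upFrom (suc ℓ) (k ∸ ℓ))))

FL : (k : ℕ) → ℕ → (ℕ → ℤ) → ℕ → LSeries
FL k m0 u B = sumL (map (termL k m0 u) (box B k))

FR : (k : ℕ) → ℕ → (ℕ → ℤ) → ℕ → ℕ → LSeries
FR k m0 u ℓ B = sumL (map (termR k m0 u ℓ) (box B k))

{-# OPTIONS --safe #-}
-- For ℓ = k the two sides coincide, since m_(k+1) = 0 and the second product is empty, so it suffices to
-- lower ℓ one step at a time. Passing from ℓ = p + 1 to ℓ = p only changes how the summand depends on
-- x = m_(p+1); with a = m_p, b = m_(p+2) + u_(p+2) - u_(p+1) and c = u_(p+1) the sum over x becomes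
--   Σ_x q^(x(x+c)) [a,x] / (q)_(x+b+c)  =  Σ_x q^(x(x+c)) [b,x] / (q)_(x+a+c),
-- times factors independent of x. Both sides satisfy the same recurrence in (a, b), coming from the
-- q-Pascal rule [a+1,x+1] = q^(x+1) [a,x+1] + [a,x], and for b = 0 both equal 1/(q)_(a+c) by the other
-- Pascal rule. The sums are truncated to the box [0,B]^k; B ≥ m0 and B ≥ |u_(k+1) - u_1| make the
-- truncation harmless: the monotonicity of u bounds b by u_(k+1) - u_1 whenever the remaining product of
-- binomials is nonzero.
module Submission where

open import Defs
open import Algebra.Bundles using (CommutativeMonoid)
open import Algebra.Structures using (IsCommutativeMonoid)
import Algebra.Properties.CommutativeSemigroup as CommSemigroupProperties
import Algebra.Solver.CommutativeMonoid as CommMonoidSolver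
open import Data.Bool using (if_then_else_)
open import Data.Fin using (toℕ)
open import Data.Fin.Properties using (toℕ<n)
open import Data.Integer as ℤ using (ℤ; +_; -[1+_]; _+_; _-_; _*_; -_; 0ℤ; 1ℤ; ∣_∣)
import Data.Integer.Properties as ℤP
open import Data.Integer.Tactic.RingSolver using (solve-∀)
open import Data.List using (List; []; _∷_; _++_; map; concatMap; upTo; applyUpTo)
open import Data.List.Properties using (map-++; map-∘; map-cong)
open import Data.Nat as ℕ using (ℕ; zero; suc; _∸_; _⊔_; _≤_; _<_; z≤n; s≤s; _≡ᵇ_)
import Data.Nat.DivMod as ℕD
import Data.Nat.Properties as ℕP
open import Data.Product using (Σ; _,_)
open import Data.Sum using (_⊎_; inj₁; inj₂)
open import Data.Empty using (⊥-elim)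
open import Data.Vec using (Vec; []; _∷_)
open import Data.Vec.Relation.Unary.All using (All; []; _∷_)
open import Function using (_∘_; id)
open import Relation.Binary.PropositionalEquality
  using (_≡_; _≢_; _≗_; refl; sym; trans; cong; cong₂; subst; _→-setoid_; module ≡-Reasoning)
open import Relation.Binary.Bundles using (Setoid)
open import Relation.Nullary using (yes; no)

open import Algebra.Properties.Semiring.Sum ℤP.+-*-semiring
  using (sum; sum-cong-≗; sum-replicate-zero; ∑-distrib-+; ∑-comm; *-distribˡ-sum)

Σ< : ℕ → (ℕ → ℤ) → ℤ
Σ< n f = sum {n} (λ i → f (toℕ i))

Σ<-cong : ∀ n {f g : ℕ → ℤ} → (∀ i → i < n → f i ≡ g i) → Σ< n f ≡ Σ< n g
Σ<-cong n f≡g = sum-cong-≗ {n} (λ i → f≡g (toℕ i) (toℕ<n i))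

Σ<-ext : ∀ n {f g : ℕ → ℤ} → f ≗ g → Σ< n f ≡ Σ< n g
Σ<-ext n f≗g = Σ<-cong n (λ i _ → f≗g i)

Σ<-zero : ∀ n (f : ℕ → ℤ) → (∀ i → i < n → f i ≡ 0ℤ) → Σ< n f ≡ 0ℤ
Σ<-zero n f f≡0 = trans (Σ<-cong n f≡0) (sum-replicate-zero n)

Σ<-distrib-+ : ∀ n (f g : ℕ → ℤ) → Σ< n (λ i → f i + g i) ≡ Σ< n f + Σ< n g
Σ<-distrib-+ n f g = ∑-distrib-+ {n} (f ∘ toℕ) (g ∘ toℕ)

*-distribˡ-Σ< : ∀ n c (f : ℕ → ℤ) → c * Σ< n f ≡ Σ< n (λ i → c * f i)
*-distribˡ-Σ< n c f = *-distribˡ-sum {n} c (f ∘ toℕ)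

Σ<-comm : ∀ n m (f : ℕ → ℕ → ℤ) → Σ< n (λ i → Σ< m (f i)) ≡ Σ< m (λ j → Σ< n (λ i → f i j))
Σ<-comm n m f = ∑-comm {n} {m} (λ i j → f (toℕ i) (toℕ j))

Σ<-truncate : ∀ n m (f : ℕ → ℤ) → n ≤ m → (∀ i → n ≤ i → f i ≡ 0ℤ) → Σ< m f ≡ Σ< n f
Σ<-truncate zero m f _ f≡0 = Σ<-zero m f (λ i _ → f≡0 i z≤n)
Σ<-truncate (suc n) (suc m) f (s≤s n≤m) f≡0 =
  cong (_+_ (f 0)) (Σ<-truncate n m (f ∘ suc) n≤m (λ i n≤i → f≡0 (suc i) (s≤s n≤i)))

sumℤ-applyUpTo : ∀ (f : ℕ → ℤ) (g : ℕ → ℕ) n → sumℤ (map f (applyUpTo g n)) ≡ Σ< n (f ∘ g)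
sumℤ-applyUpTo f g zero    = refl
sumℤ-applyUpTo f g (suc n) = cong (_+_ (f (g 0))) (sumℤ-applyUpTo f (g ∘ suc) n)

sumℤ-upTo : ∀ (f : ℕ → ℤ) n → sumℤ (map f (upTo n)) ≡ Σ< n f
sumℤ-upTo f = sumℤ-applyUpTo f id

-- Power series

infixl 6 _⊕_ _⊖_

_⊕_ : Series → Series → Series
(f ⊕ g) n = f n + g n

_⊖_ : Series → Series → Series
(f ⊖ g) n = f n - g n

-- The Cauchy product by recursion on the degree, so that its laws can be proved by induction and transported to ⊛.
cauchy : Series → Series → Series
cauchy f g zero    = f 0 * g 0
cauchy f g (suc n) = f 0 * g (suc n) + cauchy (f ∘ suc) g n

cauchy-Σ< : ∀ f g n → cauchy f g n ≡ Σ< (suc n) (λ i → f i * g (n ∸ i))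
cauchy-Σ< f g zero    = sym (ℤP.+-identityʳ _)
cauchy-Σ< f g (suc n) = cong (_+_ (f 0 * g (suc n))) (cauchy-Σ< (f ∘ suc) g n)

⊛≗cauchy : ∀ f g → (f ⊛ g) ≗ cauchy f g
⊛≗cauchy f g n = trans (sumℤ-upTo (λ i → f i * g (n ∸ i)) (suc n)) (sym (cauchy-Σ< f g n))

cauchy-congˡ : ∀ {f f'} g → f ≗ f' → cauchy f g ≗ cauchy f' g
cauchy-congˡ g f≗f' zero    = cong (_* g 0) (f≗f' 0)
cauchy-congˡ g f≗f' (suc n) =
  cong₂ _+_ (cong (_* g (suc n)) (f≗f' 0)) (cauchy-congˡ g (f≗f' ∘ suc) n)

cauchy-congʳ : ∀ f {g g'} → g ≗ g' → cauchy f g ≗ cauchy f g'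
cauchy-congʳ f g≗g' zero    = cong (f 0 *_) (g≗g' 0)
cauchy-congʳ f g≗g' (suc n) =
  cong₂ _+_ (cong (f 0 *_) (g≗g' (suc n))) (cauchy-congʳ (f ∘ suc) g≗g' n)

cauchy-zeroˡ : ∀ f g → f ≗ zeroS → cauchy f g ≗ zeroS
cauchy-zeroˡ f g f≗0 zero    rewrite f≗0 0 = ℤP.*-zeroˡ (g 0)
cauchy-zeroˡ f g f≗0 (suc n) rewrite f≗0 0 =
  cong₂ _+_ (ℤP.*-zeroˡ (g (suc n))) (cauchy-zeroˡ (f ∘ suc) g (f≗0 ∘ suc) n)

cauchy-identityˡ : ∀ g → cauchy oneS g ≗ g
cauchy-identityˡ g zero    = ℤP.*-identityˡ (g 0)
cauchy-identityˡ g (suc n) =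
  trans (cong₂ _+_ (ℤP.*-identityˡ (g (suc n))) (cauchy-zeroˡ (oneS ∘ suc) g (λ _ → refl) n))
        (ℤP.+-identityʳ _)

private
  interchange-+ : ∀ a b c d → a + b + (c + d) ≡ a + c + (b + d)
  interchange-+ = solve-∀

  minus-plus : ∀ m n → m - n + n ≡ m
  minus-plus = solve-∀

cauchy-distribʳ : ∀ f f' g → cauchy (f ⊕ f') g ≗ (cauchy f g ⊕ cauchy f' g)
cauchy-distribʳ f f' g zero    = ℤP.*-distribʳ-+ (g 0) (f 0) (f' 0)
cauchy-distribʳ f f' g (suc n) =
  trans (cong₂ _+_ (ℤP.*-distribʳ-+ (g (suc n)) (f 0) (f' 0)) (cauchy-distribʳ (f ∘ suc) (f' ∘ suc) g n))
        (interchange-+ (f 0 * g (suc n)) (f' 0 * g (suc n)) (cauchy (f ∘ suc) g n) (cauchy (f' ∘ suc) g n))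

cauchy-distribʳ-⊖ : ∀ f f' g → cauchy (f ⊖ f') g ≗ (cauchy f g ⊖ cauchy f' g)
cauchy-distribʳ-⊖ f f' g zero    = distrib (f 0) (f' 0) (g 0)
  where
  distrib : ∀ a b c → (a - b) * c ≡ a * c - b * c
  distrib = solve-∀
cauchy-distribʳ-⊖ f f' g (suc n) =
  trans (cong (_+_ ((f 0 - f' 0) * g (suc n))) (cauchy-distribʳ-⊖ (f ∘ suc) (f' ∘ suc) g n))
        (distrib (f 0) (f' 0) (g (suc n)) _ _)
  where
  distrib : ∀ a b c x y → (a - b) * c + (x - y) ≡ a * c + x - (b * c + y)
  distrib = solve-∀

cauchy-scaleˡ : ∀ c f g → cauchy (λ i → c * f i) g ≗ (λ n → c * cauchy f g n)
cauchy-scaleˡ c f g zero    = ℤP.*-assoc c (f 0) (g 0)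
cauchy-scaleˡ c f g (suc n) =
  trans (cong₂ _+_ (ℤP.*-assoc c (f 0) (g (suc n))) (cauchy-scaleˡ c (f ∘ suc) g n))
        (sym (ℤP.*-distribˡ-+ c _ _))

cauchy-assoc : ∀ f g h → cauchy (cauchy f g) h ≗ cauchy f (cauchy g h)
cauchy-assoc f g h zero    = ℤP.*-assoc (f 0) (g 0) (h 0)
cauchy-assoc f g h (suc n) =
  trans (cong (_+_ (f 0 * g 0 * h (suc n)))
          (trans (cauchy-distribʳ (λ i → f 0 * g (suc i)) (cauchy (f ∘ suc) g) h n)
                 (cong₂ _+_ (cauchy-scaleˡ (f 0) (g ∘ suc) h n) (cauchy-assoc (f ∘ suc) g h n))))
        (regroup (f 0) (g 0) (h (suc n)) _ _)
  where
  regroup : ∀ a b c x y → a * b * c + (a * x + y) ≡ a * (b * c + x) + y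
  regroup = solve-∀

cauchy-comm : ∀ f g → cauchy f g ≗ cauchy g f
cauchy-comm f g zero          = ℤP.*-comm (f 0) (g 0)
cauchy-comm f g (suc zero)    = swap (f 0) (f 1) (g 0) (g 1)
  where
  swap : ∀ a b c d → a * d + b * c ≡ c * b + d * a
  swap = solve-∀
cauchy-comm f g (suc (suc n)) = begin
  f 0 * g (2 ℕ.+ n) + cauchy (f ∘ suc) g (suc n)
    ≡⟨ cong (_+_ (f 0 * g (2 ℕ.+ n))) (cauchy-comm (f ∘ suc) g (suc n)) ⟩
  f 0 * g (2 ℕ.+ n) + (g 0 * f (2 ℕ.+ n) + cauchy (g ∘ suc) (f ∘ suc) n)
    ≡⟨ cong (λ x → f 0 * g (2 ℕ.+ n) + (g 0 * f (2 ℕ.+ n) + x)) (cauchy-comm (g ∘ suc) (f ∘ suc) n) ⟩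
  f 0 * g (2 ℕ.+ n) + (g 0 * f (2 ℕ.+ n) + cauchy (f ∘ suc) (g ∘ suc) n)
    ≡⟨ swap (f 0 * g (2 ℕ.+ n)) (g 0 * f (2 ℕ.+ n)) (cauchy (f ∘ suc) (g ∘ suc) n) ⟩
  g 0 * f (2 ℕ.+ n) + (f 0 * g (2 ℕ.+ n) + cauchy (f ∘ suc) (g ∘ suc) n)
    ≡⟨ cong (_+_ (g 0 * f (2 ℕ.+ n))) (cauchy-comm (g ∘ suc) f (suc n)) ⟨
  g 0 * f (2 ℕ.+ n) + cauchy (g ∘ suc) f (suc n) ∎
  where
  open ≡-Reasoning
  swap : ∀ a b c → a + (b + c) ≡ b + (a + c)
  swap = solve-∀

⊛-cong : ∀ {f f' g g'} → f ≗ f' → g ≗ g' → (f ⊛ g) ≗ (f' ⊛ g')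
⊛-cong {f} {f'} {g} {g'} f≗f' g≗g' n =
  trans (⊛≗cauchy f g n) (trans (cauchy-congˡ g f≗f' n)
  (trans (cauchy-congʳ f' g≗g' n) (sym (⊛≗cauchy f' g' n))))

⊛-congˡ : ∀ {f f'} g → f ≗ f' → (f ⊛ g) ≗ (f' ⊛ g)
⊛-congˡ g f≗f' = ⊛-cong {g = g} f≗f' (λ _ → refl)

⊛-congʳ : ∀ f {g g'} → g ≗ g' → (f ⊛ g) ≗ (f ⊛ g')
⊛-congʳ f g≗g' = ⊛-cong {f = f} (λ _ → refl) g≗g'

⊛-comm : ∀ f g → (f ⊛ g) ≗ (g ⊛ f)
⊛-comm f g n = trans (⊛≗cauchy f g n) (trans (cauchy-comm f g n) (sym (⊛≗cauchy g f n)))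

⊛-assoc : ∀ f g h → ((f ⊛ g) ⊛ h) ≗ (f ⊛ (g ⊛ h))
⊛-assoc f g h n =
  trans (⊛≗cauchy _ h n) (trans (cauchy-congˡ h (⊛≗cauchy f g) n)
  (trans (cauchy-assoc f g h n) (trans (cauchy-congʳ f (λ m → sym (⊛≗cauchy g h m)) n)
  (sym (⊛≗cauchy f _ n)))))

⊛-identityˡ : ∀ g → (oneS ⊛ g) ≗ g
⊛-identityˡ g n = trans (⊛≗cauchy oneS g n) (cauchy-identityˡ g n)

⊛-identityʳ : ∀ g → (g ⊛ oneS) ≗ g
⊛-identityʳ g n = trans (⊛-comm g oneS n) (⊛-identityˡ g n)

⊛-zeroˡ : ∀ f g → f ≗ zeroS → (f ⊛ g) ≗ zeroS
⊛-zeroˡ f g f≗0 n = trans (⊛≗cauchy f g n) (cauchy-zeroˡ f g f≗0 n)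

⊛-zeroʳ : ∀ f g → g ≗ zeroS → (f ⊛ g) ≗ zeroS
⊛-zeroʳ f g g≗0 n = trans (⊛-comm f g n) (⊛-zeroˡ g f g≗0 n)

⊛-distribʳ : ∀ f f' g → ((f ⊕ f') ⊛ g) ≗ ((f ⊛ g) ⊕ (f' ⊛ g))
⊛-distribʳ f f' g n = trans (⊛≗cauchy _ g n) (trans (cauchy-distribʳ f f' g n)
  (sym (cong₂ _+_ (⊛≗cauchy f g n) (⊛≗cauchy f' g n))))

⊛-distribʳ-⊖ : ∀ f f' g → ((f ⊖ f') ⊛ g) ≗ ((f ⊛ g) ⊖ (f' ⊛ g))
⊛-distribʳ-⊖ f f' g n = trans (⊛≗cauchy _ g n) (trans (cauchy-distribʳ-⊖ f f' g n)
  (sym (cong₂ _-_ (⊛≗cauchy f g n) (⊛≗cauchy f' g n))))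

⊛-distribˡ-⊖ : ∀ f g g' → (f ⊛ (g ⊖ g')) ≗ ((f ⊛ g) ⊖ (f ⊛ g'))
⊛-distribˡ-⊖ f g g' n = trans (⊛-comm f (g ⊖ g') n) (trans (⊛-distribʳ-⊖ g g' f n)
  (cong₂ _-_ (⊛-comm g f n) (⊛-comm g' f n)))

⊛-isCommutativeMonoid : IsCommutativeMonoid _≗_ _⊛_ oneS
⊛-isCommutativeMonoid = record
  { isMonoid = record
    { isSemigroup = record
      { isMagma = record
        { isEquivalence = Setoid.isEquivalence (ℕ →-setoid ℤ)
        ; ∙-cong = ⊛-cong }
      ; assoc = ⊛-assoc }
    ; identity = ⊛-identityˡ , ⊛-identityʳ }
  ; comm = ⊛-comm }

⊛-commutativeMonoid : CommutativeMonoid _ _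
⊛-commutativeMonoid = record { isCommutativeMonoid = ⊛-isCommutativeMonoid }

open CommSemigroupProperties (CommutativeMonoid.commutativeSemigroup ⊛-commutativeMonoid)
  using (interchange; x∙yz≈y∙xz)
open CommMonoidSolver ⊛-commutativeMonoid using (solve; _⊜_) renaming (_⊕_ to _∙_)

infix 25 q·_ q^_

q·_ : Series → Series
(q· g) zero    = 0ℤ
(q· g) (suc n) = g n

q^_ : ℕ → Series
q^ zero    = oneS
q^ (suc j) = q· q^ j

q·-cong : ∀ {f g} → f ≗ g → q· f ≗ q· g
q·-cong f≗g zero    = refl
q·-cong f≗g (suc n) = f≗g n

q·-⊛ : ∀ f g → ((q· f) ⊛ g) ≗ q· (f ⊛ g)
q·-⊛ f g zero    = trans (⊛≗cauchy (q· f) g 0) (ℤP.*-zeroˡ (g 0))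
q·-⊛ f g (suc n) =
  trans (⊛≗cauchy (q· f) g (suc n))
  (trans (trans (cong (_+ cauchy f g n) (ℤP.*-zeroˡ (g (suc n)))) (ℤP.+-identityˡ _))
         (sym (⊛≗cauchy f g n)))

q^-+ : ∀ i j → (q^ i ⊛ q^ j) ≗ q^ (i ℕ.+ j)
q^-+ zero    j = ⊛-identityˡ (q^ j)
q^-+ (suc i) j n = trans (q·-⊛ (q^ i) (q^ j) n) (q·-cong (q^-+ i j) n)

q^-⊛-≥ : ∀ j g n → j ≤ n → (q^ j ⊛ g) n ≡ g (n ∸ j)
q^-⊛-≥ zero    g n       _         = ⊛-identityˡ g n
q^-⊛-≥ (suc j) g (suc n) (s≤s j≤n) = trans (q·-⊛ (q^ j) g (suc n)) (q^-⊛-≥ j g n j≤n)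

q^-⊛-< : ∀ j g n → n < j → (q^ j ⊛ g) n ≡ 0ℤ
q^-⊛-< (suc j) g zero    _         = q·-⊛ (q^ j) g zero
q^-⊛-< (suc j) g (suc n) (s≤s n<j) = trans (q·-⊛ (q^ j) g (suc n)) (q^-⊛-< j g n n<j)

coeffℤ : ℤ → Series → ℤ
coeffℤ (+ n)    S = S n
coeffℤ -[1+ _ ] S = 0ℤ

shiftL≡coeffℤ : ∀ e S N → shiftL e S N ≡ coeffℤ (N - e) S
shiftL≡coeffℤ e S N with N - e
... | + j      = refl
... | -[1+ _ ] = refl

coeffℤ-cong : ∀ z {S T} → S ≗ T → coeffℤ z S ≡ coeffℤ z T
coeffℤ-cong (+ n)    S≗T = S≗T n
coeffℤ-cong -[1+ _ ] S≗T = refl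

coeffℤ-zero : ∀ z S → S ≗ zeroS → coeffℤ z S ≡ 0ℤ
coeffℤ-zero (+ n)    S S≗0 = S≗0 n
coeffℤ-zero -[1+ _ ] S S≗0 = refl

coeffℤ-⊕ : ∀ z f g → coeffℤ z (f ⊕ g) ≡ coeffℤ z f + coeffℤ z g
coeffℤ-⊕ (+ n)    f g = refl
coeffℤ-⊕ -[1+ _ ] f g = refl

coeffℤ-⊖ : ∀ z f g → coeffℤ z (f ⊖ g) ≡ coeffℤ z f - coeffℤ z g
coeffℤ-⊖ (+ n)    f g = refl
coeffℤ-⊖ -[1+ _ ] f g = refl

coeffℤ-<0 : ∀ n j S → n < j → coeffℤ (+ n - + j) S ≡ 0ℤ
coeffℤ-<0 n (suc j) S (s≤s n≤j)
  rewrite ℤP.m-n≡m⊖n n (suc j) | ℤP.⊖-< (s≤s n≤j) | ℕP.+-∸-assoc 1 n≤j = refl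

coeffℤ-≥0 : ∀ n j S → j ≤ n → coeffℤ (+ n - + j) S ≡ S (n ∸ j)
coeffℤ-≥0 n j S j≤n = cong (λ z → coeffℤ z S) (trans (ℤP.m-n≡m⊖n n j) (ℤP.⊖-≥ j≤n))

coeffℤ-q^-⊛ : ∀ z j S → coeffℤ z (q^ j ⊛ S) ≡ coeffℤ (z - + j) S
coeffℤ-q^-⊛ -[1+ n ] zero    S = refl
coeffℤ-q^-⊛ -[1+ n ] (suc j) S = refl
coeffℤ-q^-⊛ (+ n)    j       S with ℕP.≤-<-connex j n
... | inj₁ j≤n = trans (q^-⊛-≥ j S n j≤n) (sym (coeffℤ-≥0 n j S j≤n))
... | inj₂ n<j = trans (q^-⊛-< j S n n<j) (sym (coeffℤ-<0 n j S n<j))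

-- Geometric series and q-Pochhammer symbols

q^≡if : ∀ i n → (q^ i) n ≡ (if n ≡ᵇ i then 1ℤ else 0ℤ)
q^≡if zero    zero    = refl
q^≡if zero    (suc n) = refl
q^≡if (suc i) zero    = refl
q^≡if (suc i) (suc n) = q^≡if i n

oneMinusQ≗ : ∀ i → oneMinusQ i ≗ (oneS ⊖ q^ i)
oneMinusQ≗ i n = sym (cong₂ _-_ (q^≡if 0 n) (q^≡if i n))

⊛-oneMinusQ : ∀ C j → (C ⊛ oneMinusQ j) ≗ (C ⊖ (C ⊛ q^ j))
⊛-oneMinusQ C j n =
  trans (⊛-congʳ C (oneMinusQ≗ j) n)
  (trans (⊛-distribˡ-⊖ C oneS (q^ j) n) (cong (_- (C ⊛ q^ j) n) (⊛-identityʳ C n)))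

oneMinusQ-⊛-geomInv : ∀ i → (oneMinusQ (suc i) ⊛ geomInv (suc i)) ≗ oneS
oneMinusQ-⊛-geomInv i n =
  trans (⊛-comm (oneMinusQ (suc i)) G n)
  (trans (⊛-oneMinusQ G (suc i) n)
  (trans (cong (_-_ (G n)) (⊛-comm G (q^ (suc i)) n)) (telescope n)))
  where
  G = geomInv (suc i)
  telescope : ∀ n → G n - (q^ (suc i) ⊛ G) n ≡ oneS n
  telescope n with ℕP.≤-<-connex (suc i) n
  ... | inj₁ i<n
    rewrite q^-⊛-≥ (suc i) G n i<n | ℕD.m≤n⇒[n∸m]%m≡n%m {suc i} {n} i<n | ℤP.+-inverseʳ (G n)
    with n | i<n
  ...   | suc _ | _ = refl
  telescope n | inj₂ n≤i
    rewrite q^-⊛-< (suc i) G n n≤i | ℤP.+-identityʳ (G n) | ℕD.m<n⇒m%n≡m {suc i} {n} n≤i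
    with n
  ...   | zero  = refl
  ...   | suc _ = refl

∏-from : (ℕ → Series) → ℕ → ℕ → Series
∏-from f a n = prodS (map f (upFrom a n))

∏-from-cong : ∀ {f g} a n → (∀ i → a ≤ i → i < a ℕ.+ n → f i ≗ g i) → ∏-from f a n ≗ ∏-from g a n
∏-from-cong a zero    f≗g = λ _ → refl
∏-from-cong a (suc n) f≗g =
  ⊛-cong (f≗g a ℕP.≤-refl (ℕP.m<m+n a (s≤s z≤n)))
         (∏-from-cong (suc a) n (λ i a<i i<an → f≗g i (ℕP.<⇒≤ a<i) (subst (i <_) (sym (ℕP.+-suc a n)) i<an)))

∏-from-snoc : ∀ f a n → ∏-from f a (suc n) ≗ (∏-from f a n ⊛ f (a ℕ.+ n))
∏-from-snoc f a zero    m =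
  trans (⊛-identityʳ (f a) m)
  (trans (cong (λ x → f x m) (sym (ℕP.+-identityʳ a))) (sym (⊛-identityˡ (f (a ℕ.+ 0)) m)))
∏-from-snoc f a (suc n) m =
  trans (⊛-congʳ (f a) (∏-from-snoc f (suc a) n) m)
  (trans (sym (⊛-assoc (f a) (∏-from f (suc a) n) (f (suc a ℕ.+ n)) m))
         (⊛-congʳ (f a ⊛ ∏-from f (suc a) n) (λ m → cong (λ x → f x m) (sym (ℕP.+-suc a n))) m))

∏-from-⊛ : ∀ f g a n → (∏-from f a n ⊛ ∏-from g a n) ≗ ∏-from (λ i → f i ⊛ g i) a n
∏-from-⊛ f g a zero    = ⊛-identityˡ oneS
∏-from-⊛ f g a (suc n) m =
  trans (interchange (f a) (∏-from f (suc a) n) (g a) (∏-from g (suc a) n) m)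
        (⊛-congʳ (f a ⊛ g a) (∏-from-⊛ f g (suc a) n) m)

∏-from-one : ∀ f a n → (∀ i → a ≤ i → i < a ℕ.+ n → f i ≗ oneS) → ∏-from f a n ≗ oneS
∏-from-one f a n f≗1 m = trans (∏-from-cong a n f≗1 m) (∏-one a n m)
  where
  ∏-one : ∀ a n → ∏-from (λ _ → oneS) a n ≗ oneS
  ∏-one a zero    = λ _ → refl
  ∏-one a (suc n) m = trans (⊛-identityˡ (∏-from (λ _ → oneS) (suc a) n) m) (∏-one (suc a) n m)

poch-⊛-invPoch : ∀ n → (poch n ⊛ invPoch n) ≗ oneS
poch-⊛-invPoch n m =
  trans (∏-from-⊛ oneMinusQ geomInv 1 n m)
        (∏-from-one _ 1 n (λ { (suc i) _ _ → oneMinusQ-⊛-geomInv i }) m)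

oneMinusQ-⊛-invPoch-suc : ∀ n → (oneMinusQ (suc n) ⊛ invPoch (suc n)) ≗ invPoch n
oneMinusQ-⊛-invPoch-suc n m = begin
  (oneMinusQ (suc n) ⊛ invPoch (suc n)) m
    ≡⟨ ⊛-congʳ (oneMinusQ (suc n)) (∏-from-snoc geomInv 1 n) m ⟩
  (oneMinusQ (suc n) ⊛ (invPoch n ⊛ geomInv (suc n))) m
    ≡⟨ x∙yz≈y∙xz (oneMinusQ (suc n)) (invPoch n) (geomInv (suc n)) m ⟩
  (invPoch n ⊛ (oneMinusQ (suc n) ⊛ geomInv (suc n))) m
    ≡⟨ ⊛-congʳ (invPoch n) (oneMinusQ-⊛-geomInv n) m ⟩
  (invPoch n ⊛ oneS) m
    ≡⟨ ⊛-identityʳ (invPoch n) m ⟩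
  invPoch n m ∎
  where open ≡-Reasoning

-- q-binomial coefficients

qbin : ℕ → ℕ → Series
qbin n m = qbinom (+ n) (+ m)

qbinom-formula : ∀ n a b → n - + a ≡ + b → qbinom n (+ a) ≗ ((poch (a ℕ.+ b) ⊛ invPoch a) ⊛ invPoch b)
qbinom-formula n a b eq k rewrite eq = refl

qbinom-> : ∀ n m → n ℤ.< + m → qbinom n (+ m) ≗ zeroS
qbinom-> n m n<m = vanish (n - + m) refl
  where
  vanish : ∀ z → n - + m ≡ z → qbinom n (+ m) ≗ zeroS
  vanish -[1+ _ ] eq k rewrite eq = refl
  vanish (+ t)    eq = ⊥-elim (ℤP.<⇒≱ n<m (begin
    + m           ≤⟨ ℤ.+≤+ (ℕP.m≤n+m m t) ⟩
    + t + + m     ≡⟨ cong (_+ + m) eq ⟨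
    n - + m + + m ≡⟨ minus-plus n (+ m) ⟩
    n             ∎))
    where open ℤP.≤-Reasoning

qbin-formula : ∀ n m r → m ℕ.+ r ≡ n → qbin n m ≗ ((poch n ⊛ invPoch m) ⊛ invPoch r)
qbin-formula _ m r refl = qbinom-formula (+ (m ℕ.+ r)) m r
  (trans (ℤP.m-n≡m⊖n (m ℕ.+ r) m) (trans (ℤP.⊖-≥ (ℕP.m≤m+n m r)) (cong +_ (ℕP.m+n∸m≡n m r))))

qbin-> : ∀ n m → n < m → qbin n m ≗ zeroS
qbin-> n m n<m = qbinom-> (+ n) m (ℤ.+<+ n<m)

qbin-zero : ∀ n → qbin n 0 ≗ oneS
qbin-zero n k =
  trans (qbin-formula n 0 n refl k)
  (trans (⊛-congˡ (invPoch n) (⊛-identityʳ (poch n)) k) (poch-⊛-invPoch n k))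

qbin-diag : ∀ n → qbin n n ≗ oneS
qbin-diag n k =
  trans (qbin-formula n n 0 (ℕP.+-identityʳ n) k)
  (trans (⊛-identityʳ (poch n ⊛ invPoch n) k) (poch-⊛-invPoch n k))

⊛-oneMinusQ-+ : ∀ C i j →
  (C ⊛ oneMinusQ (i ℕ.+ j)) ≗ ((C ⊛ oneMinusQ i) ⊕ (q^ i ⊛ (C ⊛ oneMinusQ j)))
⊛-oneMinusQ-+ C i j k = sym (begin
  (C ⊛ oneMinusQ i) k + (q^ i ⊛ (C ⊛ oneMinusQ j)) k
    ≡⟨ cong₂ _+_ (⊛-oneMinusQ C i k) (⊛-congʳ (q^ i) (⊛-oneMinusQ C j) k) ⟩
  C k - (C ⊛ q^ i) k + (q^ i ⊛ (C ⊖ (C ⊛ q^ j))) k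
    ≡⟨ cong (_+_ (C k - (C ⊛ q^ i) k)) (⊛-distribˡ-⊖ (q^ i) C (C ⊛ q^ j) k) ⟩
  C k - (C ⊛ q^ i) k + ((q^ i ⊛ C) k - (q^ i ⊛ (C ⊛ q^ j)) k)
    ≡⟨ cong₂ (λ x y → C k - (C ⊛ q^ i) k + (x - y)) (⊛-comm (q^ i) C k) (q^-absorb k) ⟩
  C k - (C ⊛ q^ i) k + ((C ⊛ q^ i) k - (C ⊛ q^ (i ℕ.+ j)) k)
    ≡⟨ ℤP.+-minus-telescope (C k) ((C ⊛ q^ i) k) ((C ⊛ q^ (i ℕ.+ j)) k) ⟩
  C k - (C ⊛ q^ (i ℕ.+ j)) k
    ≡⟨ ⊛-oneMinusQ C (i ℕ.+ j) k ⟨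
  (C ⊛ oneMinusQ (i ℕ.+ j)) k ∎)
  where
  open ≡-Reasoning
  q^-absorb : (q^ i ⊛ (C ⊛ q^ j)) ≗ (C ⊛ q^ (i ℕ.+ j))
  q^-absorb k =
    trans (x∙yz≈y∙xz (q^ i) C (q^ j) k) (⊛-congʳ C (q^-+ i j) k)

-- With a = x + r + 1, the three binomials of the Pascal rules are C (1 - q^(a+1)),
-- C (1 - q^(r+1)) and C (1 - q^(x+1)) for C = (q)_a / ((q)_(x+1) (q)_(r+1)).
module _ (x r : ℕ) where
  private
    a = suc (x ℕ.+ r)
    C = (poch a ⊛ invPoch (suc x)) ⊛ invPoch (suc r)

    top : qbin (suc a) (suc x) ≗ (C ⊛ oneMinusQ (suc a))
    top k =
      trans (qbin-formula (suc a) (suc x) (suc r) (cong suc (ℕP.+-suc x r)) k)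
      (trans (⊛-congˡ (invPoch (suc r)) (⊛-congˡ (invPoch (suc x)) (∏-from-snoc oneMinusQ 1 a)) k)
             (solve 4 (λ P Z X Y → ((P ∙ Z) ∙ X) ∙ Y ⊜ ((P ∙ X) ∙ Y) ∙ Z) (λ _ → refl)
                    (poch a) (oneMinusQ (suc a)) (invPoch (suc x)) (invPoch (suc r)) k))

    left : qbin a (suc x) ≗ (C ⊛ oneMinusQ (suc r))
    left k =
      trans (qbin-formula a (suc x) r refl k)
      (trans (⊛-congʳ (poch a ⊛ invPoch (suc x)) (λ t → sym (oneMinusQ-⊛-invPoch-suc r t)) k)
             (solve 4 (λ P X Z Y → (P ∙ X) ∙ (Z ∙ Y) ⊜ ((P ∙ X) ∙ Y) ∙ Z) (λ _ → refl)
                    (poch a) (invPoch (suc x)) (oneMinusQ (suc r)) (invPoch (suc r)) k))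

    right : qbin a x ≗ (C ⊛ oneMinusQ (suc x))
    right k =
      trans (qbin-formula a x (suc r) (ℕP.+-suc x r) k)
      (trans (⊛-congˡ (invPoch (suc r)) (⊛-congʳ (poch a) (λ t → sym (oneMinusQ-⊛-invPoch-suc x t))) k)
             (solve 4 (λ P Z X Y → (P ∙ (Z ∙ X)) ∙ Y ⊜ ((P ∙ X) ∙ Y) ∙ Z) (λ _ → refl)
                    (poch a) (oneMinusQ (suc x)) (invPoch (suc x)) (invPoch (suc r)) k))

  qbin-pascal₁-< : qbin (suc a) (suc x) ≗ (qbin a (suc x) ⊕ (q^ (suc r) ⊛ qbin a x))
  qbin-pascal₁-< k = begin
    qbin (suc a) (suc x) k
      ≡⟨ top k ⟩
    (C ⊛ oneMinusQ (suc a)) k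
      ≡⟨ cong (λ i → (C ⊛ oneMinusQ i) k) (cong suc (trans (cong suc (ℕP.+-comm x r)) (sym (ℕP.+-suc r x)))) ⟩
    (C ⊛ oneMinusQ (suc r ℕ.+ suc x)) k
      ≡⟨ ⊛-oneMinusQ-+ C (suc r) (suc x) k ⟩
    (C ⊛ oneMinusQ (suc r)) k + (q^ (suc r) ⊛ (C ⊛ oneMinusQ (suc x))) k
      ≡⟨ cong₂ _+_ (left k) (⊛-congʳ (q^ (suc r)) right k) ⟨
    qbin a (suc x) k + (q^ (suc r) ⊛ qbin a x) k ∎
    where open ≡-Reasoning

  qbin-pascal₂-< : qbin (suc a) (suc x) ≗ ((q^ (suc x) ⊛ qbin a (suc x)) ⊕ qbin a x)
  qbin-pascal₂-< k = begin
    qbin (suc a) (suc x) k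
      ≡⟨ top k ⟩
    (C ⊛ oneMinusQ (suc a)) k
      ≡⟨ cong (λ i → (C ⊛ oneMinusQ (suc i)) k) (sym (ℕP.+-suc x r)) ⟩
    (C ⊛ oneMinusQ (suc x ℕ.+ suc r)) k
      ≡⟨ ⊛-oneMinusQ-+ C (suc x) (suc r) k ⟩
    (C ⊛ oneMinusQ (suc x)) k + (q^ (suc x) ⊛ (C ⊛ oneMinusQ (suc r))) k
      ≡⟨ cong₂ _+_ (right k) (⊛-congʳ (q^ (suc x)) left k) ⟨
    qbin a x k + (q^ (suc x) ⊛ qbin a (suc x)) k
      ≡⟨ ℤP.+-comm (qbin a x k) _ ⟩
    (q^ (suc x) ⊛ qbin a (suc x)) k + qbin a x k ∎
    where open ≡-Reasoning

private
  ≤-view : ∀ x a → x ≤ a → x ≡ a ⊎ Σ ℕ (λ r → a ≡ suc (x ℕ.+ r))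
  ≤-view x a x≤a with ℕP.m≤n⇒m<n∨m≡n x≤a
  ... | inj₁ x<a = inj₂ (a ∸ suc x , sym (ℕP.m+[n∸m]≡n x<a))
  ... | inj₂ x≡a = inj₁ x≡a

qbin-pascal₁ : ∀ a x → x ≤ a → qbin (suc a) (suc x) ≗ (qbin a (suc x) ⊕ (q^ (a ∸ x) ⊛ qbin a x))
qbin-pascal₁ a x x≤a with ≤-view x a x≤a
... | inj₁ refl = λ k → trans (qbin-diag (suc x) k) (sym (begin
  qbin x (suc x) k + (q^ (x ∸ x) ⊛ qbin x x) k
    ≡⟨ cong₂ _+_ (qbin-> x (suc x) ℕP.≤-refl k) (cong (λ i → (q^ i ⊛ qbin x x) k) (ℕP.n∸n≡0 x)) ⟩
  0ℤ + (oneS ⊛ qbin x x) k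
    ≡⟨ trans (ℤP.+-identityˡ _) (⊛-identityˡ (qbin x x) k) ⟩
  qbin x x k
    ≡⟨ qbin-diag x k ⟩
  oneS k ∎))
  where open ≡-Reasoning
... | inj₂ (r , refl) = λ k → trans (qbin-pascal₁-< x r k)
  (cong (_+_ (qbin a (suc x) k)) (cong (λ i → (q^ i ⊛ qbin a x) k) (sym a∸x≡1+r)))
  where
  a∸x≡1+r : suc (x ℕ.+ r) ∸ x ≡ suc r
  a∸x≡1+r = trans (ℕP.+-∸-assoc 1 (ℕP.m≤m+n x r)) (cong suc (ℕP.m+n∸m≡n x r))

qbin-pascal₂ : ∀ a x → x ≤ a → qbin (suc a) (suc x) ≗ ((q^ (suc x) ⊛ qbin a (suc x)) ⊕ qbin a x)
qbin-pascal₂ a x x≤a with ≤-view x a x≤a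
... | inj₁ refl = λ k → trans (qbin-diag (suc x) k) (sym (begin
  (q^ (suc x) ⊛ qbin x (suc x)) k + qbin x x k
    ≡⟨ cong₂ _+_ (⊛-zeroʳ (q^ (suc x)) (qbin x (suc x)) (qbin-> x (suc x) ℕP.≤-refl) k) (qbin-diag x k) ⟩
  0ℤ + oneS k
    ≡⟨ ℤP.+-identityˡ (oneS k) ⟩
  oneS k ∎))
  where open ≡-Reasoning
... | inj₂ (r , refl) = qbin-pascal₂-< x r

-- The one-variable identity

binomTerm : ℕ → ℤ → ℤ → ℕ → LSeries
binomTerm a d c x N = coeffℤ (N - + x * (+ x + c)) (qbin a x ⊛ invPochℤ (+ x + d))

binomSum : ℕ → ℤ → ℤ → LSeries
binomSum a d c N = Σ< (suc a) (λ x → binomTerm a d c x N)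

binomSum-truncate : ∀ M a d c N → a < M → Σ< M (λ x → binomTerm a d c x N) ≡ binomSum a d c N
binomSum-truncate M a d c N a<M = Σ<-truncate (suc a) M (λ x → binomTerm a d c x N) a<M (λ x a<x →
  coeffℤ-zero (N - + x * (+ x + c)) (qbin a x ⊛ invPochℤ (+ x + d)) (⊛-zeroˡ (qbin a x) (invPochℤ (+ x + d)) (qbin-> a x a<x)))

binomTerm-zero : ∀ a d c N → binomTerm a d c 0 N ≡ coeffℤ N (invPochℤ d)
binomTerm-zero a d c N = begin
  coeffℤ (N - 0ℤ * (0ℤ + c)) (qbin a 0 ⊛ invPochℤ (0ℤ + d))
    ≡⟨ cong₂ coeffℤ (cong (_-_ N) (ℤP.*-zeroˡ (0ℤ + c))) (cong (λ e → qbin a 0 ⊛ invPochℤ e) (ℤP.+-identityˡ d)) ⟩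
  coeffℤ (N - 0ℤ) (qbin a 0 ⊛ invPochℤ d)
    ≡⟨ cong₂ coeffℤ (ℤP.+-identityʳ N) refl ⟩
  coeffℤ N (qbin a 0 ⊛ invPochℤ d)
    ≡⟨ coeffℤ-cong N (λ k → trans (⊛-congˡ (invPochℤ d) (qbin-zero a) k) (⊛-identityˡ (invPochℤ d) k)) ⟩
  coeffℤ N (invPochℤ d) ∎
  where open ≡-Reasoning

private
  coeffℤ-q^-qbin : ∀ z j a x S → coeffℤ z ((q^ j ⊛ qbin a x) ⊛ S) ≡ coeffℤ (z - + j) (qbin a x ⊛ S)
  coeffℤ-q^-qbin z j a x S =
    trans (coeffℤ-cong z (⊛-assoc (q^ j) (qbin a x) S)) (coeffℤ-q^-⊛ z j (qbin a x ⊛ S))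

  coeffℤ-⊕-⊛ : ∀ z f g S → coeffℤ z ((f ⊕ g) ⊛ S) ≡ coeffℤ z (f ⊛ S) + coeffℤ z (g ⊛ S)
  coeffℤ-⊕-⊛ z f g S = trans (coeffℤ-cong z (⊛-distribʳ f g S)) (coeffℤ-⊕ z (f ⊛ S) (g ⊛ S))

binomTerm-pascal₁ : ∀ a d c x N → x ≤ a →
  binomTerm (suc a) d c (suc x) N ≡
  binomTerm a d c (suc x) N + binomTerm a (d + 1ℤ) (c + 1ℤ) x (N - (+ suc a + c))
binomTerm-pascal₁ a d c x N x≤a = begin
  coeffℤ z (qbin (suc a) (suc x) ⊛ I)
    ≡⟨ coeffℤ-cong z (⊛-congˡ I (qbin-pascal₁ a x x≤a)) ⟩
  coeffℤ z ((qbin a (suc x) ⊕ (q^ (a ∸ x) ⊛ qbin a x)) ⊛ I)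
    ≡⟨ coeffℤ-⊕-⊛ z (qbin a (suc x)) (q^ (a ∸ x) ⊛ qbin a x) I ⟩
  binomTerm a d c (suc x) N + coeffℤ z ((q^ (a ∸ x) ⊛ qbin a x) ⊛ I)
    ≡⟨ cong (_+_ (binomTerm a d c (suc x) N)) (coeffℤ-q^-qbin z (a ∸ x) a x I) ⟩
  binomTerm a d c (suc x) N + coeffℤ (z - + (a ∸ x)) (qbin a x ⊛ I)
    ≡⟨ cong (_+_ (binomTerm a d c (suc x) N)) (cong₂ coeffℤ exponent (cong (λ e → qbin a x ⊛ invPochℤ e) (shift-index (+ x) d))) ⟩
  binomTerm a d c (suc x) N + binomTerm a (d + 1ℤ) (c + 1ℤ) x (N - (+ suc a + c)) ∎
  where
  open ≡-Reasoning
  z = N - + suc x * (+ suc x + c)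
  I = invPochℤ (+ suc x + d)
  shift-index : ∀ X d → (1ℤ + X) + d ≡ X + (d + 1ℤ)
  shift-index = solve-∀
  identity : ∀ N X A c → N - ((1ℤ + X) * ((1ℤ + X) + c)) - (A - X) ≡ N - ((1ℤ + A) + c) - (X * (X + (c + 1ℤ)))
  identity = solve-∀
  exponent : z - + (a ∸ x) ≡ N - (+ suc a + c) - + x * (+ x + (c + 1ℤ))
  exponent = trans (cong (_-_ z) (sym (trans (ℤP.m-n≡m⊖n a x) (ℤP.⊖-≥ x≤a)))) (identity N (+ x) (+ a) c)

binomTerm-pascal₂ : ∀ a d c x N → x ≤ a →
  binomTerm (suc a) d c (suc x) N ≡
  binomTerm a d (c + 1ℤ) (suc x) N + binomTerm a (d + 1ℤ) (c + 1ℤ + 1ℤ) x (N - (1ℤ + c))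
binomTerm-pascal₂ a d c x N x≤a = begin
  coeffℤ z (qbin (suc a) (suc x) ⊛ I)
    ≡⟨ coeffℤ-cong z (⊛-congˡ I (qbin-pascal₂ a x x≤a)) ⟩
  coeffℤ z (((q^ (suc x) ⊛ qbin a (suc x)) ⊕ qbin a x) ⊛ I)
    ≡⟨ coeffℤ-⊕-⊛ z (q^ (suc x) ⊛ qbin a (suc x)) (qbin a x) I ⟩
  coeffℤ z ((q^ (suc x) ⊛ qbin a (suc x)) ⊛ I) + coeffℤ z (qbin a x ⊛ I)
    ≡⟨ cong₂ _+_ (coeffℤ-q^-qbin z (suc x) a (suc x) I) refl ⟩
  coeffℤ (z - + suc x) (qbin a (suc x) ⊛ I) + coeffℤ z (qbin a x ⊛ I)
    ≡⟨ cong₂ _+_ (cong₂ coeffℤ (exponent₁ N (+ x) c) refl)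
                 (cong₂ coeffℤ (exponent₂ N (+ x) c) (cong (λ e → qbin a x ⊛ invPochℤ e) (shift-index (+ x) d))) ⟩
  binomTerm a d (c + 1ℤ) (suc x) N + binomTerm a (d + 1ℤ) (c + 1ℤ + 1ℤ) x (N - (1ℤ + c)) ∎
  where
  open ≡-Reasoning
  z = N - + suc x * (+ suc x + c)
  I = invPochℤ (+ suc x + d)
  shift-index : ∀ X d → (1ℤ + X) + d ≡ X + (d + 1ℤ)
  shift-index = solve-∀
  exponent₁ : ∀ N X c → N - ((1ℤ + X) * ((1ℤ + X) + c)) - (1ℤ + X) ≡ N - ((1ℤ + X) * ((1ℤ + X) + (c + 1ℤ)))
  exponent₁ = solve-∀
  exponent₂ : ∀ N X c → N - ((1ℤ + X) * ((1ℤ + X) + c)) ≡ N - (1ℤ + c) - (X * (X + (c + 1ℤ + 1ℤ)))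
  exponent₂ = solve-∀

binomSum-recurrence : ∀ a {d c c₀ d' c'} N N' →
  binomTerm (suc a) d c 0 N ≡ binomTerm a d c₀ 0 N →
  (∀ x → x ≤ a → binomTerm (suc a) d c (suc x) N ≡ binomTerm a d c₀ (suc x) N + binomTerm a d' c' x N') →
  binomSum (suc a) d c N ≡ binomSum a d c₀ N + binomSum a d' c' N'
binomSum-recurrence a {d} {c} {c₀} {d'} {c'} N N' at-zero at-suc = begin
  t (suc a) c 0 + Σ< (suc a) (λ x → t (suc a) c (suc x))
    ≡⟨ cong₂ _+_ at-zero (Σ<-cong (suc a) (λ x x<1+a → at-suc x (ℕP.≤-pred x<1+a))) ⟩
  t a c₀ 0 + Σ< (suc a) (λ x → t a c₀ (suc x) + binomTerm a d' c' x N')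
    ≡⟨ cong (_+_ (t a c₀ 0)) (Σ<-distrib-+ (suc a) (λ x → t a c₀ (suc x)) (λ x → binomTerm a d' c' x N')) ⟩
  t a c₀ 0 + (Σ< (suc a) (λ x → t a c₀ (suc x)) + binomSum a d' c' N')
    ≡⟨ ℤP.+-assoc (t a c₀ 0) _ _ ⟨
  Σ< (suc (suc a)) (λ x → t a c₀ x) + binomSum a d' c' N'
    ≡⟨ cong (_+ binomSum a d' c' N') (binomSum-truncate (suc (suc a)) a d c₀ N (s≤s (ℕP.n≤1+n a))) ⟩
  binomSum a d c₀ N + binomSum a d' c' N' ∎
  where
  open ≡-Reasoning
  t : ℕ → ℤ → ℕ → ℤ
  t a c x = binomTerm a d c x N

binomSum-pascal₁ : ∀ a d c N →
  binomSum (suc a) d c N ≡ binomSum a d c N + binomSum a (d + 1ℤ) (c + 1ℤ) (N - (+ suc a + c))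
binomSum-pascal₁ a d c N = binomSum-recurrence a {d} {c} {c} {d + 1ℤ} {c + 1ℤ} N (N - (+ suc a + c))
  (trans (binomTerm-zero (suc a) d c N) (sym (binomTerm-zero a d c N)))
  (λ x x≤a → binomTerm-pascal₁ a d c x N x≤a)

binomSum-pascal₂ : ∀ a d c N →
  binomSum (suc a) d c N ≡ binomSum a d (c + 1ℤ) N + binomSum a (d + 1ℤ) (c + 1ℤ + 1ℤ) (N - (1ℤ + c))
binomSum-pascal₂ a d c N = binomSum-recurrence a {d} {c} {c + 1ℤ} {d + 1ℤ} {c + 1ℤ + 1ℤ} N (N - (1ℤ + c))
  (trans (binomTerm-zero (suc a) d c N) (sym (binomTerm-zero a d (c + 1ℤ) N)))
  (λ x x≤a → binomTerm-pascal₂ a d c x N x≤a)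

invPochℤ-step : ∀ m N → coeffℤ N (invPochℤ (m - 1ℤ)) + coeffℤ (N - m) (invPochℤ m) ≡ coeffℤ N (invPochℤ m)
invPochℤ-step -[1+ k ] N = trans (cong₂ _+_ (coeffℤ-zero N zeroS (λ _ → refl)) (coeffℤ-zero (N - -[1+ k ]) zeroS (λ _ → refl)))
                                 (sym (coeffℤ-zero N zeroS (λ _ → refl)))
invPochℤ-step (+ zero)  N =
  trans (cong₂ _+_ (coeffℤ-zero N zeroS (λ _ → refl)) (cong (λ z → coeffℤ z (invPoch 0)) (ℤP.+-identityʳ N)))
        (ℤP.+-identityˡ _)
invPochℤ-step (+ suc j) N = begin
  coeffℤ N (invPoch j) + coeffℤ (N - + suc j) I
    ≡⟨ cong (_+ coeffℤ (N - + suc j) I) (coeffℤ-cong N (λ k → trans (sym (oneMinusQ-⊛-invPoch-suc j k)) (⊛-comm (oneMinusQ (suc j)) I k))) ⟩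
  coeffℤ N (I ⊛ oneMinusQ (suc j)) + coeffℤ (N - + suc j) I
    ≡⟨ cong (_+ coeffℤ (N - + suc j) I) (trans (coeffℤ-cong N (⊛-oneMinusQ I (suc j))) (coeffℤ-⊖ N I (I ⊛ q^ (suc j)))) ⟩
  coeffℤ N I - coeffℤ N (I ⊛ q^ (suc j)) + coeffℤ (N - + suc j) I
    ≡⟨ cong (λ y → coeffℤ N I - y + coeffℤ (N - + suc j) I)
            (trans (coeffℤ-cong N (⊛-comm I (q^ (suc j)))) (coeffℤ-q^-⊛ N (suc j) I)) ⟩
  coeffℤ N I - coeffℤ (N - + suc j) I + coeffℤ (N - + suc j) I
    ≡⟨ minus-plus (coeffℤ N I) (coeffℤ (N - + suc j) I) ⟩
  coeffℤ N I ∎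
  where
  open ≡-Reasoning
  I = invPoch (suc j)

binomSum-closed : ∀ b c N → binomSum b c c N ≡ coeffℤ N (invPochℤ (+ b + c))
binomSum-closed zero    c N =
  trans (ℤP.+-identityʳ _) (trans (binomTerm-zero 0 c c N) (cong (λ e → coeffℤ N (invPochℤ e)) (sym (ℤP.+-identityˡ c))))
binomSum-closed (suc b) c N = begin
  binomSum (suc b) c c N
    ≡⟨ binomSum-pascal₁ b c c N ⟩
  binomSum b c c N + binomSum b (c + 1ℤ) (c + 1ℤ) (N - (+ suc b + c))
    ≡⟨ cong₂ _+_ (binomSum-closed b c N) (binomSum-closed b (c + 1ℤ) (N - (+ suc b + c))) ⟩
  coeffℤ N (invPochℤ (+ b + c)) + coeffℤ (N - (+ suc b + c)) (invPochℤ (+ b + (c + 1ℤ)))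
    ≡⟨ cong₂ (λ e e' → coeffℤ N (invPochℤ e) + coeffℤ (N - (+ suc b + c)) (invPochℤ e'))
             (predecessor (+ b) c) (successor (+ b) c) ⟩
  coeffℤ N (invPochℤ (+ suc b + c - 1ℤ)) + coeffℤ (N - (+ suc b + c)) (invPochℤ (+ suc b + c))
    ≡⟨ invPochℤ-step (+ suc b + c) N ⟩
  coeffℤ N (invPochℤ (+ suc b + c)) ∎
  where
  open ≡-Reasoning
  predecessor : ∀ B c → B + c ≡ (1ℤ + B) + c - 1ℤ
  predecessor = solve-∀
  successor : ∀ B c → B + (c + 1ℤ) ≡ (1ℤ + B) + c
  successor = solve-∀

binomSum-symmetric : ∀ a b c N → binomSum a (+ b + c) c N ≡ binomSum b (+ a + c) c N
binomSum-symmetric zero b c N = begin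
  binomSum 0 (+ b + c) c N
    ≡⟨ trans (ℤP.+-identityʳ _) (binomTerm-zero 0 (+ b + c) c N) ⟩
  coeffℤ N (invPochℤ (+ b + c))
    ≡⟨ binomSum-closed b c N ⟨
  binomSum b c c N
    ≡⟨ cong (λ d → binomSum b d c N) (ℤP.+-identityˡ c) ⟨
  binomSum b (0ℤ + c) c N ∎
  where open ≡-Reasoning
binomSum-symmetric (suc a) zero c N = sym (binomSum-symmetric zero (suc a) c N)
binomSum-symmetric (suc a) (suc b) c N = begin
  binomSum (suc a) (+ suc b + c) c N
    ≡⟨ binomSum-pascal₂ a (+ suc b + c) c N ⟩
  binomSum a (+ suc b + c) (c + 1ℤ) N + binomSum a (+ suc b + c + 1ℤ) (c + 1ℤ + 1ℤ) N'
    ≡⟨ cong₂ _+_ (trans (cong (λ d → binomSum a d (c + 1ℤ) N) (shift₁ (+ b) c))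
                        (binomSum-symmetric a b (c + 1ℤ) N))
                 (trans (cong (λ d → binomSum a d (c + 1ℤ + 1ℤ) N') (shift₂ (+ b) c))
                        (binomSum-symmetric a b (c + 1ℤ + 1ℤ) N')) ⟩
  binomSum b (+ a + (c + 1ℤ)) (c + 1ℤ) N + binomSum b (+ a + (c + 1ℤ + 1ℤ)) (c + 1ℤ + 1ℤ) N'
    ≡⟨ cong₂ _+_ (cong (λ d → binomSum b d (c + 1ℤ) N) (shift₁ (+ a) c))
                 (cong (λ d → binomSum b d (c + 1ℤ + 1ℤ) N') (shift₂ (+ a) c)) ⟨
  binomSum b (+ suc a + c) (c + 1ℤ) N + binomSum b (+ suc a + c + 1ℤ) (c + 1ℤ + 1ℤ) N'
    ≡⟨ binomSum-pascal₂ b (+ suc a + c) c N ⟨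
  binomSum (suc b) (+ suc a + c) c N ∎
  where
  open ≡-Reasoning
  N' = N - (1ℤ + c)
  shift₁ : ∀ B c → (1ℤ + B) + c ≡ B + (c + 1ℤ)
  shift₁ = solve-∀
  shift₂ : ∀ B c → (1ℤ + B) + c + 1ℤ ≡ B + (c + 1ℤ + 1ℤ)
  shift₂ = solve-∀

laurentSum : ℕ → (ℕ → ℤ) → (ℕ → Series) → LSeries
laurentSum n e S N = Σ< n (λ x → coeffℤ (N - e x) (S x))

coeffℤ-⊛ : ∀ z S K J → z ℤ.< + J → coeffℤ z (S ⊛ K) ≡ Σ< J (λ j → K j * coeffℤ (z - + j) S)
coeffℤ-⊛ (+ t) S K J (ℤ.+<+ t<J) = begin
  (S ⊛ K) t
    ≡⟨ trans (⊛-comm S K t) (trans (⊛≗cauchy K S t) (cauchy-Σ< K S t)) ⟩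
  Σ< (suc t) (λ j → K j * S (t ∸ j))
    ≡⟨ Σ<-cong (suc t) (λ j j≤t → cong (K j *_) (coeffℤ-≥0 t j S (ℕP.≤-pred j≤t))) ⟨
  Σ< (suc t) (λ j → K j * coeffℤ (+ t - + j) S)
    ≡⟨ Σ<-truncate (suc t) J _ t<J (λ j t<j → trans (cong (K j *_) (coeffℤ-<0 t j S t<j)) (ℤP.*-zeroʳ (K j))) ⟨
  Σ< J (λ j → K j * coeffℤ (+ t - + j) S) ∎
  where open ≡-Reasoning
coeffℤ-⊛ -[1+ n ] S K J _ = sym (Σ<-zero J _ (λ j _ → trans (cong (K j *_) (negative j)) (ℤP.*-zeroʳ (K j))))
  where
  negative : ∀ j → coeffℤ (-[1+ n ] - + j) S ≡ 0ℤ
  negative zero    = refl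
  negative (suc j) = refl

private
  max< : ℕ → (ℕ → ℕ) → ℕ
  max< zero    f = 0
  max< (suc n) f = f 0 ⊔ max< n (f ∘ suc)

  ≤-max< : ∀ n f x → x < n → f x ≤ max< n f
  ≤-max< (suc n) f zero    _         = ℕP.m≤m⊔n (f 0) _
  ≤-max< (suc n) f (suc x) (s≤s x<n) = ℕP.≤-trans (≤-max< n (f ∘ suc) x x<n) (ℕP.m≤n⊔m (f 0) _)

  <-suc-∣∣ : ∀ z m → ∣ z ∣ ≤ m → z ℤ.< + suc m
  <-suc-∣∣ (+ t)    m t≤m = ℤ.+<+ (s≤s t≤m)
  <-suc-∣∣ -[1+ _ ] m _   = ℤ.-<+

laurentSum-⊛ : ∀ n e X Y K → (∀ N → laurentSum n e X N ≡ laurentSum n e Y N) →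
  ∀ N → laurentSum n e (λ x → X x ⊛ K) N ≡ laurentSum n e (λ x → Y x ⊛ K) N
laurentSum-⊛ n e X Y K X≡Y N =
  trans (expand X) (trans (Σ<-ext deg (λ j → cong (K j *_) (X≡Y (N - + j)))) (sym (expand Y)))
  where
  -- exceeds every degree N - e x that occurs, so all the convolutions can be cut off at deg
  deg = suc (max< n (λ x → ∣ N - e x ∣))
  reorder : ∀ N E j → N - E - j ≡ N - j - E
  reorder = solve-∀
  expand : ∀ Z → laurentSum n e (λ x → Z x ⊛ K) N ≡ Σ< deg (λ j → K j * laurentSum n e Z (N - + j))
  expand Z = begin
    Σ< n (λ x → coeffℤ (N - e x) (Z x ⊛ K))
      ≡⟨ Σ<-cong n (λ x x<n → coeffℤ-⊛ (N - e x) (Z x) K deg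
                                (<-suc-∣∣ _ _ (≤-max< n (λ x → ∣ N - e x ∣) x x<n))) ⟩
    Σ< n (λ x → Σ< deg (λ j → K j * coeffℤ (N - e x - + j) (Z x)))
      ≡⟨ Σ<-comm n deg (λ x j → K j * coeffℤ (N - e x - + j) (Z x)) ⟩
    Σ< deg (λ j → Σ< n (λ x → K j * coeffℤ (N - e x - + j) (Z x)))
      ≡⟨ Σ<-ext deg (λ j → trans (Σ<-ext n (λ x → cong (λ z → K j * coeffℤ z (Z x)) (reorder N (e x) (+ j))))
                               (sym (*-distribˡ-Σ< n (K j) (λ x → coeffℤ (N - + j - e x) (Z x))))) ⟩
    Σ< deg (λ j → K j * laurentSum n e Z (N - + j)) ∎
    where open ≡-Reasoning

laurentSum-qbin-symmetric : ∀ M a b c → a < M → b < M → ∀ N →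
  laurentSum M (λ x → + x * (+ x + c)) (λ x → qbin a x ⊛ invPochℤ (+ x + (+ b + c))) N ≡
  laurentSum M (λ x → + x * (+ x + c)) (λ x → qbin b x ⊛ invPochℤ (+ x + (+ a + c))) N
laurentSum-qbin-symmetric M a b c a<M b<M N =
  trans (binomSum-truncate M a (+ b + c) c N a<M)
  (trans (binomSum-symmetric a b c N) (sym (binomSum-truncate M b (+ a + c) c N b<M)))

-- Sums over boxes of index vectors

sumℤ-++ : ∀ xs ys → sumℤ (xs ++ ys) ≡ sumℤ xs + sumℤ ys
sumℤ-++ []       ys = sym (ℤP.+-identityˡ _)
sumℤ-++ (x ∷ xs) ys = trans (cong (_+_ x) (sumℤ-++ xs ys)) (sym (ℤP.+-assoc x _ _))

sumℤ-concatMap : ∀ {A B : Set} (f : B → ℤ) (g : A → List B) xs →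
  sumℤ (map f (concatMap g xs)) ≡ sumℤ (map (λ x → sumℤ (map f (g x))) xs)
sumℤ-concatMap f g []       = refl
sumℤ-concatMap f g (x ∷ xs) =
  trans (cong sumℤ (map-++ f (g x) (concatMap g xs)))
  (trans (sumℤ-++ (map f (g x)) (map f (concatMap g xs))) (cong (_+_ (sumℤ (map f (g x)))) (sumℤ-concatMap f g xs)))

boxSum : (k B : ℕ) → (Vec ℕ k → ℤ) → ℤ
boxSum zero    B f = f []
boxSum (suc k) B f = Σ< (suc B) (λ x → boxSum k B (λ v → f (x ∷ v)))

sumℤ-box : ∀ k B f → sumℤ (map f (box B k)) ≡ boxSum k B f
sumℤ-box zero    B f = ℤP.+-identityʳ (f [])
sumℤ-box (suc k) B f =
  trans (sumℤ-concatMap f (λ x → map (x ∷_) (box B k)) (upTo (suc B)))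
  (trans (cong sumℤ (map-cong (λ x → trans (cong sumℤ (sym (map-∘ (box B k)))) (sumℤ-box k B (λ v → f (x ∷ v)))) (upTo (suc B))))
         (sumℤ-upTo (λ x → boxSum k B (λ v → f (x ∷ v))) (suc B)))

sumL-map : ∀ {A : Set} (F : A → LSeries) xs N → sumL (map F xs) N ≡ sumℤ (map (λ v → F v N) xs)
sumL-map F xs N = cong sumℤ (sym (map-∘ xs))

boxSum-cong : ∀ k B {f g} → (∀ v → All (_≤ B) v → f v ≡ g v) → boxSum k B f ≡ boxSum k B g
boxSum-cong zero    B f≡g = f≡g [] []
boxSum-cong (suc k) B f≡g =
  Σ<-cong (suc B) (λ x x≤B → boxSum-cong k B (λ v v≤B → f≡g (x ∷ v) (ℕP.≤-pred x≤B ∷ v≤B)))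

boxSum-Σ< : ∀ k B n (f : ℕ → Vec ℕ k → ℤ) → boxSum k B (λ v → Σ< n (λ x → f x v)) ≡ Σ< n (λ x → boxSum k B (f x))
boxSum-Σ< zero    B n f = refl
boxSum-Σ< (suc k) B n f =
  trans (Σ<-ext (suc B) (λ y → boxSum-Σ< k B n (λ x v → f x (y ∷ v))))
        (Σ<-comm (suc B) n (λ y x → boxSum k B (λ v → f x (y ∷ v))))

insert : ∀ {k} → ℕ → ℕ → Vec ℕ k → Vec ℕ (suc k)
insert zero    x w       = x ∷ w
insert (suc p) x []      = x ∷ []
insert (suc p) x (y ∷ w) = y ∷ insert p x w

boxSum-insert : ∀ p k B f → boxSum (suc k) B f ≡ boxSum k B (λ w → Σ< (suc B) (λ x → f (insert p x w)))
boxSum-insert zero    k       B f = sym (boxSum-Σ< k B (suc B) (λ x w → f (x ∷ w)))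
boxSum-insert (suc p) zero    B f = refl
boxSum-insert (suc p) (suc k) B f = Σ<-ext (suc B) (λ y → boxSum-insert p k B (λ v → f (y ∷ v)))

vget-insert : ∀ {k} p x (w : Vec ℕ k) → p ≤ k → vget (insert p x w) p ≡ x
vget-insert zero    x w       _         = refl
vget-insert (suc p) x (y ∷ w) (s≤s p≤k) = vget-insert p x w p≤k

vget-insert-≢ : ∀ {k} p x y (w : Vec ℕ k) j → p ≤ k → j ≢ p → vget (insert p x w) j ≡ vget (insert p y w) j
vget-insert-≢ zero    x y w       zero    _         j≢p = ⊥-elim (j≢p refl)
vget-insert-≢ zero    x y w       (suc j) _         _   = refl
vget-insert-≢ (suc p) x y (z ∷ w) zero    _         _   = refl
vget-insert-≢ (suc p) x y (z ∷ w) (suc j) (s≤s p≤k) j≢p = vget-insert-≢ p x y w j p≤k (j≢p ∘ cong suc)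

All-insert : ∀ {k} {P : ℕ → Set} p {x} {w : Vec ℕ k} → P x → All P w → All P (insert p x w)
All-insert zero    Px Pw         = Px ∷ Pw
All-insert (suc p) Px []         = Px ∷ []
All-insert (suc p) Px (Py ∷ Pw)  = Py ∷ All-insert p Px Pw

vget-beyond : ∀ {k} (v : Vec ℕ k) j → k ≤ j → vget v j ≡ 0
vget-beyond []      j       _         = refl
vget-beyond (x ∷ v) (suc j) (s≤s k≤j) = vget-beyond v j k≤j

coord : ∀ {k} → ℕ → Vec ℕ k → ℕ → ℕ
coord m0 v zero    = m0
coord m0 v (suc i) = vget v i

mAt≡coord : ∀ {k} m0 (v : Vec ℕ k) i → mAt m0 v i ≡ + coord m0 v i
mAt≡coord m0 v zero    = refl
mAt≡coord m0 v (suc i) = refl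

coord-bounded : ∀ {k} {B} m0 {v : Vec ℕ k} → m0 ≤ B → All (_≤ B) v → ∀ i → coord m0 v i ≤ B
coord-bounded m0 m0≤B v≤B zero    = m0≤B
coord-bounded m0 m0≤B v≤B (suc i) = vget-bounded v≤B i
  where
  vget-bounded : ∀ {k B} {v : Vec ℕ k} → All (_≤ B) v → ∀ i → vget v i ≤ B
  vget-bounded []          i       = z≤n
  vget-bounded (x≤B ∷ _)   zero    = x≤B
  vget-bounded (_ ∷ v≤B)   (suc i) = vget-bounded v≤B i

mAt-insert : ∀ {k} m0 p x (w : Vec ℕ k) → p ≤ k → mAt m0 (insert p x w) (suc p) ≡ + x
mAt-insert m0 p x w p≤k = cong +_ (vget-insert p x w p≤k)

mAt-insert-≢ : ∀ {k} m0 p x y (w : Vec ℕ k) i → p ≤ k → i ≢ suc p →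
  mAt m0 (insert p x w) i ≡ mAt m0 (insert p y w) i
mAt-insert-≢ m0 p x y w zero    p≤k _   = refl
mAt-insert-≢ m0 p x y w (suc i) p≤k i≢p = cong +_ (vget-insert-≢ p x y w i p≤k (i≢p ∘ cong suc))

chainFactor : ∀ {k} → ℕ → Vec ℕ k → ℕ → Series
chainFactor m0 v i = qbinom (mAt m0 v (i ∸ 1)) (mAt m0 v i)

tailFactor : ∀ {k} → ℕ → (ℕ → ℤ) → Vec ℕ k → ℕ → Series
tailFactor m0 u v i = qbinom (mAt m0 v (suc i) + u (suc i) - u i) (mAt m0 v i)

qbinom-vanishes-or-≤ : ∀ n m → qbinom n m ≗ zeroS ⊎ m ℤ.≤ n
qbinom-vanishes-or-≤ n -[1+ _ ] = inj₁ (λ _ → refl)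
qbinom-vanishes-or-≤ n (+ m) with + m ℤP.≤? n
... | yes m≤n = inj₂ m≤n
... | no  m≰n = inj₁ (qbinom-> n m (ℤP.≰⇒> m≰n))

-- Unless the product of the factors [m_(i+1) + u_(i+1) - u_i, m_i] for i ≥ j vanishes,
-- m_i ≤ m_(i+1) + u_(i+1) - u_i for all of them, which telescopes to m_j + u_j ≤ u_(k+1).
∏-tailFactor-vanishes-or-bounded : ∀ {k} m0 u (v : Vec ℕ k) j n → j ℕ.+ n ≡ suc k →
  ∏-from (tailFactor m0 u v) j n ≗ zeroS ⊎ mAt m0 v j + u j ℤ.≤ u (suc k)
∏-tailFactor-vanishes-or-bounded {k} m0 u v j zero j+0≡1+k
  rewrite ℕP.+-identityʳ j | j+0≡1+k | vget-beyond v k ℕP.≤-refl = inj₂ (ℤP.≤-reflexive (ℤP.+-identityˡ (u (suc k))))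
∏-tailFactor-vanishes-or-bounded {k} m0 u v j (suc n) j+n≡1+k
  with ∏-tailFactor-vanishes-or-bounded m0 u v (suc j) n (trans (sym (ℕP.+-suc j n)) j+n≡1+k)
     | qbinom-vanishes-or-≤ (mAt m0 v (suc j) + u (suc j) - u j) (mAt m0 v j)
... | inj₁ ∏≗0 | _ = inj₁ (⊛-zeroʳ (tailFactor m0 u v j) (∏-from (tailFactor m0 u v) (suc j) n) ∏≗0)
... | inj₂ _   | inj₁ factor≗0 = inj₁ (⊛-zeroˡ (tailFactor m0 u v j) (∏-from (tailFactor m0 u v) (suc j) n) factor≗0)
... | inj₂ bounded | inj₂ mⱼ≤top =
  inj₂ (ℤP.≤-trans (ℤP.+-monoˡ-≤ (u j) mⱼ≤top) (ℤP.≤-trans (ℤP.≤-reflexive (minus-plus _ (u j))) bounded))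

sumℤ-upFrom-cong : ∀ a n {f g : ℕ → ℤ} → (∀ i → a ≤ i → i < a ℕ.+ n → f i ≡ g i) →
  sumℤ (map f (upFrom a n)) ≡ sumℤ (map g (upFrom a n))
sumℤ-upFrom-cong a zero    f≡g = refl
sumℤ-upFrom-cong a (suc n) f≡g =
  cong₂ _+_ (f≡g a ℕP.≤-refl (ℕP.m<m+n a (s≤s z≤n)))
            (sumℤ-upFrom-cong (suc a) n (λ i a<i i<an → f≡g i (ℕP.<⇒≤ a<i) (subst (i <_) (sym (ℕP.+-suc a n)) i<an)))

sumℤ-upFrom-update : ∀ a n ℓ {f g : ℕ → ℤ} → a ≤ ℓ → ℓ < a ℕ.+ n → (∀ i → i ≢ ℓ → f i ≡ g i) →
  sumℤ (map f (upFrom a n)) ≡ sumℤ (map g (upFrom a n)) + (f ℓ - g ℓ)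
sumℤ-upFrom-update a zero    ℓ a≤ℓ ℓ<a+0 _ = ⊥-elim (ℕP.<⇒≱ ℓ<a+0 (subst (_≤ ℓ) (sym (ℕP.+-identityʳ a)) a≤ℓ))
sumℤ-upFrom-update a (suc n) ℓ {f} {g} a≤ℓ ℓ<a+n f≡g with a ℕ.≟ ℓ
... | yes refl =
  trans (cong (_+_ (f a)) (sumℤ-upFrom-cong (suc a) n (λ i a<i _ → f≡g i (λ i≡a → ℕP.<⇒≢ a<i (sym i≡a)))))
        (swap (f a) (g a) _)
  where
  swap : ∀ x y s → x + s ≡ y + s + (x - y)
  swap = solve-∀
... | no  a≢ℓ =
  trans (cong₂ _+_ (f≡g a a≢ℓ) (sumℤ-upFrom-update (suc a) n ℓ (ℕP.≤∧≢⇒< a≤ℓ a≢ℓ) (subst (ℓ <_) (ℕP.+-suc a n) ℓ<a+n) f≡g))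
        (sym (ℤP.+-assoc (g a) _ _))

expo-insert : ∀ {k} m0 u p x (w : Vec ℕ k) → p ≤ k →
  expo (suc k) m0 u (insert p x w) ≡ expo (suc k) m0 u (insert p 0 w) + + x * (+ x + u (suc p))
expo-insert m0 u p x w p≤k =
  trans (sumℤ-upFrom-update 1 (suc _) (suc p) (s≤s z≤n) (s≤s (s≤s p≤k))
          (λ i i≢p → cong (λ z → z * (z + u i)) (mAt-insert-≢ m0 p x 0 w i p≤k i≢p)))
  (cong (_+_ (expo (suc _) m0 u (insert p 0 w)))
    (trans (cong₂ (λ y z → y * (y + u (suc p)) - z * (z + u (suc p))) (mAt-insert m0 p x w p≤k) (mAt-insert m0 p 0 w p≤k))
           (ℤP.+-identityʳ _)))

≤-chain : ∀ (u : ℕ → ℤ) {lo hi} → (∀ i → lo ≤ i → i ≤ hi → u i ℤ.≤ u (suc i)) →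
  ∀ {i j} → lo ≤ i → i ≤ j → j ≤ suc hi → u i ℤ.≤ u j
≤-chain u step lo≤i i≤j j≤1+hi with ℕP.m≤n⇒m<n∨m≡n i≤j
... | inj₂ refl = ℤP.≤-refl
≤-chain u step {j = suc j} lo≤i _ (s≤s j≤hi) | inj₁ (s≤s i≤j) =
  ℤP.≤-trans (≤-chain u step lo≤i i≤j (ℕP.m≤n⇒m≤1+n j≤hi)) (step j (ℕP.≤-trans lo≤i i≤j) j≤hi)

i≤+∣i∣ : ∀ i → i ℤ.≤ + ∣ i ∣
i≤+∣i∣ (+ n)    = ℤP.≤-refl
i≤+∣i∣ -[1+ n ] = ℤ.-≤+

-- v x = insert p x w places x = m_(p+1) at position p; a, n and c below are the a, b and c of
-- laurentSum-qbin-symmetric, and K₁ ⊛ K₂ collects the factors that do not depend on x.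
module _ {k' : ℕ} (m0 : ℕ) (u : ℕ → ℤ) (p : ℕ) (p≤k' : p ≤ k') (w : Vec ℕ k') where
  private
    k = suc k'
    v : ℕ → Vec ℕ k
    v x = insert p x w
    m : ℕ → ℕ → ℤ
    m x = mAt m0 (v x)
    m-fixed : ∀ x i → i ≢ suc p → m x i ≡ m 0 i
    m-fixed x i = mAt-insert-≢ m0 p x 0 w i p≤k'
    below : ∀ {i} → i ≤ p → i ≢ suc p
    below i≤p refl = ℕP.<-irrefl refl (s≤s i≤p)
    above : ∀ {i} → suc (suc p) ≤ i → i ≢ suc p
    above p+2≤i refl = ℕP.<-irrefl refl p+2≤i

    c = u (suc p)
    a = coord m0 (v 0) p
    n = m 0 (suc (suc p)) + u (suc (suc p)) - c
    K₁ = ∏-from (chainFactor m0 (v 0)) 1 p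
    K₂ = ∏-from (tailFactor m0 u (v 0)) (suc (suc p)) (k' ∸ p)
    E₀ = expo k m0 u (v 0)
    e : ℕ → ℤ
    e x = + x * (+ x + c)

    m-p : ∀ x → m x p ≡ + a
    m-p x = trans (m-fixed x p (below ℕP.≤-refl)) (mAt≡coord m0 (v 0) p)

    K₁-fixed : ∀ x → ∏-from (chainFactor m0 (v x)) 1 p ≗ K₁
    K₁-fixed x = ∏-from-cong 1 p (λ i _ i≤p t → cong₂ (λ s t' → qbinom s t' t)
      (m-fixed x (i ∸ 1) (below (ℕP.≤-trans (ℕP.m∸n≤m i 1) (ℕP.≤-pred i≤p))))
      (m-fixed x i (below (ℕP.≤-pred i≤p))))

    K₂-fixed : ∀ x → ∏-from (tailFactor m0 u (v x)) (suc (suc p)) (k' ∸ p) ≗ K₂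
    K₂-fixed x = ∏-from-cong (suc (suc p)) (k' ∸ p) (λ i p+2≤i _ t → cong₂ (λ s t' → qbinom s t' t)
      (cong (λ z → z + u (suc i) - u i) (m-fixed x (suc i) (above (ℕP.m≤n⇒m≤1+n p+2≤i))))
      (m-fixed x i (above p+2≤i)))

    coeffℤ-expo : ∀ x N S → shiftL (expo k m0 u (v x)) S N ≡ coeffℤ (N - E₀ - e x) S
    coeffℤ-expo x N S = trans (shiftL≡coeffℤ _ S N)
      (cong (λ z → coeffℤ z S) (trans (cong (_-_ N) (expo-insert m0 u p x w p≤k')) (minus-+ N E₀ (e x))))
      where
      minus-+ : ∀ N E X → N - (E + X) ≡ N - E - X
      minus-+ = solve-∀

    termR-insert-suc : ∀ x N → termR k m0 u (suc p) (v x) N ≡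
      coeffℤ (N - E₀ - e x) ((qbin a x ⊛ invPochℤ (+ x + (n + c))) ⊛ (K₁ ⊛ K₂))
    termR-insert-suc x N = trans (coeffℤ-expo x N _) (coeffℤ-cong (N - E₀ - e x) (λ t → begin
      ((invPochℤ (m x (suc p) + m x (suc (suc p)) + u (suc (suc p))) ⊛ ∏-from (chainFactor m0 (v x)) 1 (suc p))
         ⊛ ∏-from (tailFactor m0 u (v x)) (suc (suc p)) (k' ∸ p)) t
        ≡⟨ ⊛-cong (⊛-cong (λ t → cong (λ z → invPochℤ z t) index)
                          (λ t → trans (∏-from-snoc (chainFactor m0 (v x)) 1 p t) (⊛-cong (K₁-fixed x) binomial t)))
                  (K₂-fixed x) t ⟩
      ((invPochℤ (+ x + (n + c)) ⊛ (K₁ ⊛ qbin a x)) ⊛ K₂) t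
        ≡⟨ solve 4 (λ I K Q L → (I ∙ (K ∙ Q)) ∙ L ⊜ (Q ∙ I) ∙ (K ∙ L)) (λ _ → refl)
                 (invPochℤ (+ x + (n + c))) K₁ (qbin a x) K₂ t ⟩
      ((qbin a x ⊛ invPochℤ (+ x + (n + c))) ⊛ (K₁ ⊛ K₂)) t ∎))
      where
      open ≡-Reasoning
      regroup : ∀ X M U C → X + M + U ≡ X + (M + U - C + C)
      regroup = solve-∀
      index : m x (suc p) + m x (suc (suc p)) + u (suc (suc p)) ≡ + x + (n + c)
      index = trans (cong₂ (λ y z → y + z + u (suc (suc p))) (mAt-insert m0 p x w p≤k') (m-fixed x (suc (suc p)) (above ℕP.≤-refl)))
                    (regroup (+ x) (m 0 (suc (suc p))) (u (suc (suc p))) c)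
      binomial : chainFactor m0 (v x) (1 ℕ.+ p) ≗ qbin a x
      binomial t = cong₂ (λ y z → qbinom y z t) (m-p x) (mAt-insert m0 p x w p≤k')

    termR-insert : ∀ x N → termR k m0 u p (v x) N ≡
      coeffℤ (N - E₀ - e x) ((qbinom n (+ x) ⊛ invPochℤ (+ x + (+ a + c))) ⊛ (K₁ ⊛ K₂))
    termR-insert x N = trans (coeffℤ-expo x N _) (coeffℤ-cong (N - E₀ - e x) (λ t → begin
      ((invPochℤ (m x p + m x (suc p) + c) ⊛ ∏-from (chainFactor m0 (v x)) 1 p)
         ⊛ ∏-from (tailFactor m0 u (v x)) (suc p) (k ∸ p)) t
        ≡⟨ cong (λ r → ((invPochℤ (m x p + m x (suc p) + c) ⊛ ∏-from (chainFactor m0 (v x)) 1 p)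
                          ⊛ ∏-from (tailFactor m0 u (v x)) (suc p) r) t) (ℕP.+-∸-assoc 1 p≤k') ⟩
      ((invPochℤ (m x p + m x (suc p) + c) ⊛ ∏-from (chainFactor m0 (v x)) 1 p)
         ⊛ (tailFactor m0 u (v x) (suc p) ⊛ ∏-from (tailFactor m0 u (v x)) (suc (suc p)) (k' ∸ p))) t
        ≡⟨ ⊛-cong (⊛-cong (λ t → cong (λ z → invPochℤ z t) index) (K₁-fixed x))
                  (⊛-cong binomial (K₂-fixed x)) t ⟩
      ((invPochℤ (+ x + (+ a + c)) ⊛ K₁) ⊛ (qbinom n (+ x) ⊛ K₂)) t
        ≡⟨ solve 4 (λ I K Q L → (I ∙ K) ∙ (Q ∙ L) ⊜ (Q ∙ I) ∙ (K ∙ L)) (λ _ → refl)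
                 (invPochℤ (+ x + (+ a + c))) K₁ (qbinom n (+ x)) K₂ t ⟩
      ((qbinom n (+ x) ⊛ invPochℤ (+ x + (+ a + c))) ⊛ (K₁ ⊛ K₂)) t ∎))
      where
      open ≡-Reasoning
      regroup : ∀ A X C → A + X + C ≡ X + (A + C)
      regroup = solve-∀
      index : m x p + m x (suc p) + c ≡ + x + (+ a + c)
      index = trans (cong₂ (λ y z → y + z + c) (m-p x) (mAt-insert m0 p x w p≤k')) (regroup (+ a) (+ x) c)
      binomial : tailFactor m0 u (v x) (suc p) ≗ qbinom n (+ x)
      binomial t = cong₂ (λ y z → qbinom y z t)
        (cong (λ z → z + u (suc (suc p)) - c) (m-fixed x (suc (suc p)) (above ℕP.≤-refl))) (mAt-insert m0 p x w p≤k')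

    n≥0 : c ℤ.≤ u (suc (suc p)) → 0ℤ ℤ.≤ n
    n≥0 c≤u = subst (0ℤ ℤ.≤_) (sym (ℤP.+-assoc (m 0 (suc (suc p))) (u (suc (suc p))) (- c)))
      (ℤP.+-mono-≤ (ℤ.+≤+ z≤n) (ℤP.i≤j⇒0≤j-i c≤u))

    n≤∣uₖ₊₁-u₁∣ : (∀ i → 1 ≤ i → i ≤ k → u i ℤ.≤ u (suc i)) →
      m 0 (suc (suc p)) + u (suc (suc p)) ℤ.≤ u (suc k) → n ℤ.≤ + ∣ u (suc k) - u 1 ∣
    n≤∣uₖ₊₁-u₁∣ u-mono bounded = begin
      n                     ≤⟨ ℤP.+-monoˡ-≤ (- c) bounded ⟩
      u (suc k) - c         ≤⟨ ℤP.+-monoʳ-≤ (u (suc k)) (ℤP.neg-mono-≤ u₁≤c) ⟩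
      u (suc k) - u 1       ≤⟨ i≤+∣i∣ _ ⟩
      + ∣ u (suc k) - u 1 ∣ ∎
      where
      open ℤP.≤-Reasoning
      u₁≤c : u 1 ℤ.≤ c
      u₁≤c = ≤-chain u u-mono ℕP.≤-refl (s≤s z≤n) (s≤s (ℕP.m≤n⇒m≤1+n p≤k'))

  termR-step : (∀ i → 1 ≤ i → i ≤ k → u i ℤ.≤ u (suc i)) →
    ∀ B → m0 ≤ B → All (_≤ B) w → ∣ u (suc k) - u 1 ∣ ≤ B → ∀ N →
    Σ< (suc B) (λ x → termR k m0 u (suc p) (insert p x w) N) ≡ Σ< (suc B) (λ x → termR k m0 u p (insert p x w) N)
  termR-step u-mono B m0≤B w≤B uB N
    with ∏-tailFactor-vanishes-or-bounded m0 u (v 0) (suc (suc p)) (k' ∸ p) (cong (suc ∘ suc) (ℕP.m+[n∸m]≡n p≤k'))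
  ... | inj₁ K₂≗0 = Σ<-ext (suc B) (λ x →
    trans (termR-insert-suc x N) (trans (vanish (qbin a x ⊛ invPochℤ (+ x + (n + c))))
     (sym (trans (termR-insert x N) (vanish (qbinom n (+ x) ⊛ invPochℤ (+ x + (+ a + c))))))))
    where
    vanish : ∀ {x} S → coeffℤ (N - E₀ - e x) (S ⊛ (K₁ ⊛ K₂)) ≡ 0ℤ
    vanish {x} S = coeffℤ-zero (N - E₀ - e x) _ (⊛-zeroʳ S (K₁ ⊛ K₂) (⊛-zeroʳ K₁ K₂ K₂≗0))
  ... | inj₂ bounded = begin
    Σ< (suc B) (λ x → termR k m0 u (suc p) (v x) N)
      ≡⟨ Σ<-ext (suc B) (λ x → trans (termR-insert-suc x N)
           (cong (λ z → coeffℤ (N - E₀ - e x) ((qbin a x ⊛ invPochℤ (+ x + (z + c))) ⊛ (K₁ ⊛ K₂))) (sym +b≡n))) ⟩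
    laurentSum (suc B) e (λ x → (qbin a x ⊛ invPochℤ (+ x + (+ b + c))) ⊛ (K₁ ⊛ K₂)) (N - E₀)
      ≡⟨ laurentSum-⊛ (suc B) e (λ x → qbin a x ⊛ invPochℤ (+ x + (+ b + c))) (λ x → qbin b x ⊛ invPochℤ (+ x + (+ a + c)))
                      (K₁ ⊛ K₂) (laurentSum-qbin-symmetric (suc B) a b c (s≤s a≤B) (s≤s b≤B)) (N - E₀) ⟩
    laurentSum (suc B) e (λ x → (qbin b x ⊛ invPochℤ (+ x + (+ a + c))) ⊛ (K₁ ⊛ K₂)) (N - E₀)
      ≡⟨ Σ<-ext (suc B) (λ x → trans (termR-insert x N)
           (cong (λ z → coeffℤ (N - E₀ - e x) ((qbinom z (+ x) ⊛ invPochℤ (+ x + (+ a + c))) ⊛ (K₁ ⊛ K₂))) (sym +b≡n))) ⟨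
    Σ< (suc B) (λ x → termR k m0 u p (v x) N) ∎
    where
    open ≡-Reasoning
    b = ∣ n ∣
    +b≡n : + b ≡ n
    +b≡n = ℤP.0≤i⇒+∣i∣≡i (n≥0 (u-mono (suc p) (s≤s z≤n) (s≤s p≤k')))
    a≤B : a ≤ B
    a≤B = coord-bounded m0 m0≤B (All-insert p z≤n w≤B) p
    b≤B : b ≤ B
    b≤B = ℤP.drop‿+≤+ (subst (ℤ._≤ + B) (sym +b≡n) (ℤP.≤-trans (n≤∣uₖ₊₁-u₁∣ u-mono bounded) (ℤ.+≤+ uB)))

FL≡boxSum : ∀ k m0 u B N → FL k m0 u B N ≡ boxSum k B (λ v → termL k m0 u v N)
FL≡boxSum k m0 u B N = trans (sumL-map (termL k m0 u) (box B k) N) (sumℤ-box k B (λ v → termL k m0 u v N))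

FR≡boxSum : ∀ k m0 u ℓ B N → FR k m0 u ℓ B N ≡ boxSum k B (λ v → termR k m0 u ℓ v N)
FR≡boxSum k m0 u ℓ B N = trans (sumL-map (termR k m0 u ℓ) (box B k) N) (sumℤ-box k B (λ v → termR k m0 u ℓ v N))

termL≡termR : ∀ k m0 u (v : Vec ℕ k) N → termL k m0 u v N ≡ termR k m0 u k v N
termL≡termR k m0 u v N =
  trans (shiftL≡coeffℤ (expo k m0 u v) _ N)
  (trans (coeffℤ-cong (N - expo k m0 u v) (λ t → sym (begin
    ((invPochℤ (mₖ + mAt m0 v (suc k) + u (suc k)) ⊛ P) ⊛ ∏-from (tailFactor m0 u v) (suc k) (k ∸ k)) t
      ≡⟨ cong (λ r → ((invPochℤ (mₖ + mAt m0 v (suc k) + u (suc k)) ⊛ P) ⊛ ∏-from (tailFactor m0 u v) (suc k) r) t)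
              (ℕP.n∸n≡0 k) ⟩
    ((invPochℤ (mₖ + mAt m0 v (suc k) + u (suc k)) ⊛ P) ⊛ oneS) t
      ≡⟨ ⊛-identityʳ (invPochℤ (mₖ + mAt m0 v (suc k) + u (suc k)) ⊛ P) t ⟩
    (invPochℤ (mₖ + mAt m0 v (suc k) + u (suc k)) ⊛ P) t
      ≡⟨ cong (λ z → (invPochℤ (z + u (suc k)) ⊛ P) t)
              (trans (cong (λ j → mₖ + + j) (vget-beyond v k ℕP.≤-refl)) (ℤP.+-identityʳ mₖ)) ⟩
    (invPochℤ (mₖ + u (suc k)) ⊛ P) t ∎)))
  (sym (shiftL≡coeffℤ (expo k m0 u v) _ N)))
  where
  open ≡-Reasoning
  mₖ = mAt m0 v k
  P = ∏-from (chainFactor m0 v) 1 k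

FL≡FR-top : ∀ k m0 u B N → FL k m0 u B N ≡ FR k m0 u k B N
FL≡FR-top k m0 u B N = begin
  FL k m0 u B N
    ≡⟨ FL≡boxSum k m0 u B N ⟩
  boxSum k B (λ v → termL k m0 u v N)
    ≡⟨ boxSum-cong k B (λ v _ → termL≡termR k m0 u v N) ⟩
  boxSum k B (λ v → termR k m0 u k v N)
    ≡⟨ FR≡boxSum k m0 u k B N ⟨
  FR k m0 u k B N ∎
  where open ≡-Reasoning

module _ (k' m0 : ℕ) (u : ℕ → ℤ) (u-mono : ∀ i → 1 ≤ i → i ≤ suc k' → u i ℤ.≤ u (suc i))
         (B : ℕ) (m0≤B : m0 ≤ B) (uB : ∣ u (suc (suc k')) - u 1 ∣ ≤ B) where

  FR-step : ∀ p → p ≤ k' → ∀ N → FR (suc k') m0 u (suc p) B N ≡ FR (suc k') m0 u p B N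
  FR-step p p≤k' N = begin
    FR (suc k') m0 u (suc p) B N
      ≡⟨ FR≡boxSum (suc k') m0 u (suc p) B N ⟩
    boxSum (suc k') B (λ v → termR (suc k') m0 u (suc p) v N)
      ≡⟨ boxSum-insert p k' B (λ v → termR (suc k') m0 u (suc p) v N) ⟩
    boxSum k' B (λ w → Σ< (suc B) (λ x → termR (suc k') m0 u (suc p) (insert p x w) N))
      ≡⟨ boxSum-cong k' B (λ w w≤B → termR-step m0 u p p≤k' w u-mono B m0≤B w≤B uB N) ⟩
    boxSum k' B (λ w → Σ< (suc B) (λ x → termR (suc k') m0 u p (insert p x w) N))
      ≡⟨ boxSum-insert p k' B (λ v → termR (suc k') m0 u p v N) ⟨
    boxSum (suc k') B (λ v → termR (suc k') m0 u p v N)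
      ≡⟨ FR≡boxSum (suc k') m0 u p B N ⟨
    FR (suc k') m0 u p B N ∎
    where open ≡-Reasoning

  FR-constant : ∀ ℓ → ℓ ≤ suc k' → ∀ N → FR (suc k') m0 u ℓ B N ≡ FR (suc k') m0 u 0 B N
  FR-constant zero    _         N = refl
  FR-constant (suc ℓ) (s≤s ℓ≤k') N = trans (FR-step ℓ ℓ≤k' N) (FR-constant ℓ (ℕP.m≤n⇒m≤1+n ℓ≤k') N)

lemma7p2 : (k : ℕ) → 1 ≤ k → (m0 : ℕ) → (u : ℕ → ℤ)
    → (∀ i → 1 ≤ i → i ≤ k → u i ℤ.≤ u (suc i))
    → (ℓ : ℕ) → ℓ ≤ k
    → (B : ℕ) → m0 ≤ B → ∣ u (suc k) - u 1 ∣ ≤ B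
    → (N : ℤ) → FL k m0 u B N ≡ FR k m0 u ℓ B N
lemma7p2 (suc k') _ m0 u u-mono ℓ ℓ≤k B m0≤B uB N = begin
  FL k m0 u B N
    ≡⟨ FL≡FR-top k m0 u B N ⟩
  FR k m0 u k B N
    ≡⟨ FR-constant k' m0 u u-mono B m0≤B uB k ℕP.≤-refl N ⟩
  FR k m0 u 0 B N
    ≡⟨ FR-constant k' m0 u u-mono B m0≤B uB ℓ ℓ≤k N ⟨
  FR k m0 u ℓ B N ∎
  where
  open ≡-Reasoning
  k = suc k'
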